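{- Let $W$ be a finite Coxeter group. For every word $\mathbf{w}$ in the simple reflections and every $u\in W$, $R_{u,\mathbf{w}}(q)=\tau^-(T_{\mathbf{w}}T_u^{ -1})$.
   Context: $\mathcal{H}_W$ is the $\mathbb{Z}[q^{\pm1}]$-algebra with basis $\{T_w\}$ and relations $T_wT_s=qT_{ws}+(q-1)T_w$ if $\ell(ws)<\ell(w)$, $T_wT_s=T_{ws}$ otherwise; $T_{\mathbf{w}}=T_{s_1}\cdots T_{s_m}$. $\tau^-$ is the $\mathbb{Z}[q^{\pm1}]$-linear map with $\tau^-(T_w^{ -1})=\delta_{w,e}$. $R_{u,\varnothing}=\delta_{u,e}$; $R_{u,\mathbf{w}\mathbf{s}}=R_{us,\mathbf{w}}$ if $\ell(us)<\ell(u)$, and $=qR_{us,\mathbf{w}}+(q-1)R_{u,\mathbf{w}}$ if $\ell(us)>\ell(u)$. -}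

module Defs where

open import Level using (Level; 0ℓ) renaming (suc to lsuc)
open import Data.Nat as ℕ using (ℕ; zero; suc; _<?_)
open import Data.Integer as ℤ using (ℤ; +_; -[1+_]; _⊓_)
open import Data.Fin using (Fin)
open import Data.List using (List; []; _∷_; length; map; reverse; foldr)
open import Data.List.Membership.Propositional using (_∈_)
open import Data.List.Relation.Unary.Unique.Propositional using (Unique)
open import Data.Product using (Σ; _×_; _,_)
open import Relation.Binary.PropositionalEquality using (_≡_; _≢_)
open import Relation.Nullary using (Dec; yes; no; does)
open import Data.Bool using (if_then_else_)
open import Algebra.Bundles using (Group)

-- Laurent polynomials ℤ[q, q⁻¹]
-- A Laurent polynomial  mkL (c₀ ∷ c₁ ∷ … ∷ cₖ) d  denotes  Σᵢ cᵢ q^(d+i).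
-- Two Laurent polynomials are equal (_≈L_) iff all their coefficients agree.

record Laurent : Set where
  constructor mkL
  field
    coeffs : List ℤ
    shift  : ℤ

private
  index : List ℤ → ℕ → ℤ
  index []       _       = + 0
  index (c ∷ cs) zero    = c
  index (c ∷ cs) (suc n) = index cs n

  pad : ℕ → List ℤ → List ℤ
  pad zero    cs = cs
  pad (suc n) cs = + 0 ∷ pad n cs

  addL : List ℤ → List ℤ → List ℤ
  addL []       bs       = bs
  addL as       []       = as
  addL (a ∷ as) (b ∷ bs) = (a ℤ.+ b) ∷ addL as bs

  mulL : List ℤ → List ℤ → List ℤ
  mulL []       bs = []
  mulL (a ∷ as) bs = addL (map (a ℤ.*_) bs) (+ 0 ∷ mulL as bs)

coeff : Laurent → ℤ → ℤ
coeff (mkL cs d) k with k ℤ.- d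
... | + n      = index cs n
... | -[1+ _ ] = + 0

infix 4 _≈L_
_≈L_ : Laurent → Laurent → Set
a ≈L b = ∀ k → coeff a k ≡ coeff b k

infixl 6 _+L_ _-L_
infixl 7 _*L_

_+L_ : Laurent → Laurent → Laurent
mkL as d₁ +L mkL bs d₂ =
  let d = d₁ ⊓ d₂ in
  mkL (addL (pad ℤ.∣ d₁ ℤ.- d ∣ as) (pad ℤ.∣ d₂ ℤ.- d ∣ bs)) d

_*L_ : Laurent → Laurent → Laurent
mkL as d₁ *L mkL bs d₂ = mkL (mulL as bs) (d₁ ℤ.+ d₂)

-L_ : Laurent → Laurent
-L mkL as d = mkL (map ℤ.-_ as) d

_-L_ : Laurent → Laurent → Laurent
a -L b = a +L (-L b)

constL : ℤ → Laurent
constL c = mkL (c ∷ []) (+ 0)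

0L 1L qL : Laurent
0L = mkL [] (+ 0)
1L = constL (+ 1)
qL = mkL (+ 1 ∷ []) (+ 1)

module _ {c ℓ : Level} (G : Group c ℓ) where
  open Group G
  gpow : Carrier → ℕ → Carrier
  gpow x zero    = ε
  gpow x (suc k) = x ∙ gpow x k

mpow : {A : Set} → A → (A → A → A) → A → ℕ → A
mpow e _·_ x zero    = e
mpow e _·_ x (suc k) = x · mpow e _·_ x k

evalWord : {A : Set} {n : ℕ} → A → (A → A → A) → (Fin n → A) → List (Fin n) → A
evalWord e _·_ s []       = e
evalWord e _·_ s (i ∷ is) = s i · evalWord e _·_ s is

-- Coxeter systems (W, S), S = {s i | i : Fin rank}, given by a Coxeter
-- matrix m (with finite entries).  W is the group with presentation
--   ⟨ s i | (s i s j)^(m i j) = e ⟩ :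
-- the relations hold, W is generated by S (every element has a word,
-- recorded in the length data below), and every assignment of the
-- generators into a group satisfying the relations extends to a
-- homomorphism.

record CoxeterSystem : Set₁ where
  infixl 7 _·_
  field
    W      : Set
    _≟_    : (x y : W) → Dec (x ≡ y)
    e      : W
    _·_    : W → W → W
    _⁻¹    : W → W
    assoc  : ∀ x y z → (x · y) · z ≡ x · (y · z)
    idˡ    : ∀ x → e · x ≡ x
    idʳ    : ∀ x → x · e ≡ x
    invˡ   : ∀ x → (x ⁻¹) · x ≡ e
    invʳ   : ∀ x → x · (x ⁻¹) ≡ e

    rank   : ℕ
    s      : Fin rank → W
    m      : Fin rank → Fin rank → ℕ
    m-diag : ∀ i → m i i ≡ 1
    m-sym  : ∀ i j → m i j ≡ m j i
    m-off  : ∀ i j → i ≢ j → 2 ℕ.≤ m i j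

  field
    relations : ∀ i j → mpow e _·_ (s i · s j) (m i j) ≡ e
    universal : (G : Group 0ℓ 0ℓ) (f : Fin rank → Group.Carrier G) →
      (∀ i j → Group._≈_ G (gpow G (Group._∙_ G (f i) (f j)) (m i j)) (Group.ε G)) →
      Σ (W → Group.Carrier G) λ φ →
        (∀ x y → Group._≈_ G (φ (x · y)) (Group._∙_ G (φ x) (φ y))) ×
        (∀ i → Group._≈_ G (φ (s i)) (f i))

    -- Coxeter length: ℓ w is the minimal length of a word representing w
    -- (red w is a chosen reduced word; its existence also says S generates W)
    ℓ       : W → ℕ
    red     : W → List (Fin rank)
    red-eval : ∀ w → evalWord e _·_ s (red w) ≡ w
    red-len  : ∀ w → length (red w) ≡ ℓ w
    ℓ-min    : ∀ w (ws : List (Fin rank)) → evalWord e _·_ s ws ≡ w → ℓ w ℕ.≤ length ws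

record Finite (C : CoxeterSystem) : Set where
  open CoxeterSystem C
  field
    elems    : List W
    complete : ∀ w → w ∈ elems
    unique   : Unique elems

-- An element is its coordinate vector in the basis {T_w}: a function
-- W → ℤ[q^{±1}] (W is finite).  Multiplication is the bilinear extension
-- of the defining relations
--   T_w T_s = q T_{ws} + (q-1) T_w   if ℓ(ws) < ℓ(w),
--   T_w T_s = T_{ws}                 otherwise,
-- i.e. h T_x is obtained from h by right multiplying by T_s along a
-- reduced word of x (T_x = T_{s₁}⋯T_{s_k} for a reduced word s₁⋯s_k).

module Hecke (C : CoxeterSystem) (F : Finite C) where
  open CoxeterSystem C
  open Finite F

  H : Set
  H = W → Laurent

  infix 4 _≈H_
  _≈H_ : H → H → Set
  h ≈H h' = ∀ w → h w ≈L h' w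

  δ : W → W → Laurent
  δ x y = if does (x ≟ y) then 1L else 0L

  T : W → H
  T w = λ v → δ v w

  0H 1H : H
  0H = λ _ → 0L
  1H = T e

  infixl 6 _+H_
  _+H_ : H → H → H
  (h +H h') w = h w +L h' w

  infixl 7 _⊙_
  _⊙_ : Laurent → H → H
  (c ⊙ h) w = c *L h w

  -- right multiplication by T_s, s = s i, extended linearly from
  -- the defining relations on the basis:
  -- coefficient at v of h T_s is
  --   q h(vs)                 if ℓ(v) < ℓ(vs),
  --   h(vs) + (q-1) h(v)      otherwise.
  rmulS : Fin rank → H → H
  rmulS i h v =
    if does (ℓ v <? ℓ (v · s i))
      then qL *L h (v · s i)
      else h (v · s i) +L (qL -L 1L) *L h v

  rmulWord : List (Fin rank) → H → H
  rmulWord []       h = h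
  rmulWord (i ∷ is) h = rmulWord is (rmulS i h)

  private
    sumH : List W → (W → H) → H
    sumH []       f = 0H
    sumH (x ∷ xs) f = f x +H sumH xs f

  infixl 7 _*H_
  _*H_ : H → H → H
  h *H h' = sumH elems (λ x → h' x ⊙ rmulWord (red x) h)

  Tword : List (Fin rank) → H
  Tword []       = 1H
  Tword (i ∷ is) = T (s i) *H Tword is

  IsInverseOfT : W → H → Set
  IsInverseOfT w x = (T w *H x ≈H 1H) × (x *H T w ≈H 1H)

  record IsTauMinus (τ : H → Laurent) : Set where
    field
      cong   : ∀ {h h'} → h ≈H h' → τ h ≈L τ h'
      additive : ∀ h h' → τ (h +H h') ≈L τ h +L τ h'
      homogeneous : ∀ c h → τ (c ⊙ h) ≈L c *L τ h
      onInverses : ∀ w x → IsInverseOfT w x → τ x ≈L δ w e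

  -- R_{u,𝐰}; the recursion peels letters off the right end of 𝐰, so it is
  -- run on the reversed word:
  --   R_{u,∅} = δ_{u,e},
  --   R_{u,𝐰s} = R_{us,𝐰}                       if ℓ(us) < ℓ(u),
  --            = q R_{us,𝐰} + (q-1) R_{u,𝐰}     if ℓ(us) > ℓ(u).
  Rrev : W → List (Fin rank) → Laurent
  Rrev u []       = δ u e
  Rrev u (i ∷ rw) =
    if does (ℓ (u · s i) <? ℓ u)
      then Rrev (u · s i) rw
      else qL *L Rrev (u · s i) rw +L (qL -L 1L) *L Rrev u rw

  R : W → List (Fin rank) → Laurent
  R u 𝐰 = Rrev u (reverse 𝐰)

-- H_W is given by coordinates, with the product defined by multiplying on the
-- right along reduced words, so it first has to be shown associative: left
-- and right multiplications by generators commute, which rests on Tits'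
-- argument that the parity of the number of times a reflection is crossed
-- by a word depends only on the element it represents.  Then T_s is a unit,
-- T_s⁻¹ = q⁻¹ T_s + (q⁻¹ - 1), and T_s T_u⁻¹ is T_{us}⁻¹ if us < u and
-- q T_{us}⁻¹ + (q - 1) T_u⁻¹ if us > u.  Writing T_{𝐰s} T_u⁻¹ = T_𝐰 (T_s T_u⁻¹),
-- this is the recursion defining R, and linearity of τ⁻ with
-- τ⁻(T_u⁻¹) = δ_{u,e} closes the induction on 𝐰.

module Submission where

open import Defs
open import Algebra.Bundles using (Monoid)
open import Data.Fin using (Fin)
open import Data.List using (List; reverse)
open import Data.List.Properties using (reverse-involutive)
open import Data.Product using (_,_)
open import Relation.Binary.PropositionalEquality using (cong)
import Relation.Binary.Reasoning.Setoid as SetoidReasoning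

module MonoidInverses {c ℓ} (M : Monoid c ℓ) where

  open Monoid M
  open import Algebra.Properties.Monoid M using (cancelᶜ; insertʳ)
  open import Data.Product using (_×_)
  open import Relation.Binary.Reasoning.Setoid setoid

  IsInverse : Carrier → Carrier → Set ℓ
  IsInverse a x = a ∙ x ≈ ε × x ∙ a ≈ ε

  inverse-∙ : ∀ {a b c x y} → a ∙ b ≈ c → IsInverse a x → IsInverse b y → IsInverse c (y ∙ x)
  inverse-∙ {a} {b} {x = x} {y} ab≈c (ax≈ε , xa≈ε) (by≈ε , yb≈ε) =
    trans (∙-congʳ (sym ab≈c)) (trans (cancelᶜ by≈ε a x) ax≈ε) ,
    trans (∙-congˡ (sym ab≈c)) (trans (cancelᶜ xa≈ε y b) yb≈ε)

  inverse-of-prefix : ∀ {a b c x y} → a ∙ b ≈ c → IsInverse c x → IsInverse b y → IsInverse a (b ∙ x)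
  inverse-of-prefix {a} {b} {x = x} {y} ab≈c (cx≈ε , xc≈ε) (by≈ε , _) = a[bx]≈ε , [bx]a≈ε
    where
    a[bx]≈ε : a ∙ (b ∙ x) ≈ ε
    a[bx]≈ε = trans (sym (assoc a b x)) (trans (∙-congʳ ab≈c) cx≈ε)
    [bx]a≈ε : (b ∙ x) ∙ a ≈ ε
    [bx]a≈ε = begin
      (b ∙ x) ∙ a             ≈⟨ insertʳ by≈ε ((b ∙ x) ∙ a) ⟩
      (((b ∙ x) ∙ a) ∙ b) ∙ y ≈⟨ ∙-congʳ (trans (assoc (b ∙ x) a b) (assoc b x (a ∙ b))) ⟩
      (b ∙ (x ∙ (a ∙ b))) ∙ y ≈⟨ ∙-congʳ (trans (∙-congˡ (trans (∙-congˡ ab≈c) xc≈ε)) (identityʳ b)) ⟩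
      b ∙ y                   ≈⟨ by≈ε ⟩
      ε                       ∎

module Permutations where

  open import Level using (0ℓ)
  open import Algebra.Bundles using (Group)
  open import Relation.Binary.PropositionalEquality

  record Perm (X : Set) : Set where
    field
      to from : X → X
      to-from : ∀ x → to (from x) ≡ x
      from-to : ∀ x → from (to x) ≡ x
  open Perm public

  -- Products are diagrammatic: in p ∙ p', p acts first.
  permGroup : Set → Group 0ℓ 0ℓ
  permGroup X = record
    { Carrier = Perm X
    ; _≈_ = λ p p' → ∀ x → to p x ≡ to p' x
    ; _∙_ = λ p p' → record
        { to = λ x → to p' (to p x) ; from = λ x → from p (from p' x)
        ; to-from = λ x → trans (cong (to p') (to-from p (from p' x))) (to-from p' x)
        ; from-to = λ x → trans (cong (from p) (from-to p' (to p x))) (from-to p x) }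
    ; ε = record { to = λ x → x ; from = λ x → x ; to-from = λ _ → refl ; from-to = λ _ → refl }
    ; _⁻¹ = λ p → record { to = from p ; from = to p ; to-from = from-to p ; from-to = to-from p }
    ; isGroup = record
      { isMonoid = record
        { isSemigroup = record
          { isMagma = record
            { isEquivalence = record { refl = λ _ → refl ; sym = λ p≈ x → sym (p≈ x) ; trans = λ p≈ q≈ x → trans (p≈ x) (q≈ x) }
            ; ∙-cong = λ {p} {p'} {q} {q'} p≈ q≈ x → trans (cong (to q) (p≈ x)) (q≈ (to p' x)) }
          ; assoc = λ _ _ _ _ → refl }
        ; identity = (λ _ _ → refl) , (λ _ _ → refl) }
      ; inverse = (λ p x → to-from p x) , (λ p x → from-to p x)
      ; ⁻¹-cong = λ {p} {q} p≈ x → trans (sym (from-to q (from p x))) (cong (from q) (trans (sym (p≈ (from p x))) (to-from p x))) } }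

module LaurentRing where

  open import Level using (0ℓ)
  open import Data.Integer as ℤ using (ℤ; +_; -[1+_]; _+_; _*_; _-_; -_)
  import Data.Integer.Properties as ℤ
  open import Data.Integer.Tactic.RingSolver using (solve-∀)
  open import Data.List using (List; []; _∷_; [_]; map)
  open import Data.Nat using (ℕ; zero; suc)
  import Data.Nat.Properties as ℕ
  open import Algebra.Bundles using (CommutativeRing)
  open import Algebra.Structures using (IsCommutativeRing)
  open import Relation.Binary.PropositionalEquality hiding ([_])
  open import Tactic.RingSolver.Core.AlmostCommutativeRing using (AlmostCommutativeRing; fromCommutativeRing)
  open import Data.Maybe using (nothing)
  open ≡-Reasoning

  -- List lookup is private to Defs; at shift -[1+ n ], coefficient -1 is entry n.
  entry : List ℤ → ℤ → ℤ
  entry cs (+ n)    = coeff (mkL cs -[1+ n ]) -[1+ 0 ]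
  entry cs -[1+ _ ] = + 0

  coeff-mkL : ∀ cs d k → coeff (mkL cs d) k ≡ entry cs (k - d)
  coeff-mkL cs d k with k - d
  ... | + n      = refl
  ... | -[1+ n ] = refl

  entry-[] : ∀ j → entry [] j ≡ + 0
  entry-[] (+ zero)  = refl
  entry-[] (+ suc n) = refl
  entry-[] -[1+ n ]  = refl

  entry-∷ : ∀ c cs j → entry (c ∷ cs) j ≡ entry [ c ] j + entry cs (j - + 1)
  entry-∷ c cs (+ zero)  = sym (ℤ.+-identityʳ c)
  entry-∷ c cs (+ suc n) = sym (ℤ.+-identityˡ _)
  entry-∷ c cs -[1+ n ]  = refl

  entry-singleton : ∀ x j → entry [ x ] j ≡ x * entry [ + 1 ] j
  entry-singleton x (+ zero)  = sym (ℤ.*-identityʳ x)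
  entry-singleton x (+ suc n) = sym (ℤ.*-zeroʳ x)
  entry-singleton x -[1+ n ]  = sym (ℤ.*-zeroʳ x)

  coeff-q^ : ℤ → ℤ → ℤ
  coeff-q^ d k = coeff (mkL [ + 1 ] d) k

  coeff-[] : ∀ d k → coeff (mkL [] d) k ≡ + 0
  coeff-[] d k = trans (coeff-mkL [] d k) (entry-[] (k - d))

  coeff-singleton : ∀ x d k → coeff (mkL [ x ] d) k ≡ x * coeff-q^ d k
  coeff-singleton x d k = begin
    coeff (mkL [ x ] d) k     ≡⟨ coeff-mkL [ x ] d k ⟩
    entry [ x ] (k - d)       ≡⟨ entry-singleton x (k - d) ⟩
    x * entry [ + 1 ] (k - d) ≡⟨ cong (x *_) (sym (coeff-mkL [ + 1 ] d k)) ⟩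
    x * coeff-q^ d k          ∎

  coeff-∷ : ∀ c cs d k → coeff (mkL (c ∷ cs) d) k ≡ c * coeff-q^ d k + coeff (mkL cs (d + + 1)) k
  coeff-∷ c cs d k = begin
    coeff (mkL (c ∷ cs) d) k                         ≡⟨ coeff-mkL (c ∷ cs) d k ⟩
    entry (c ∷ cs) (k - d)                           ≡⟨ entry-∷ c cs (k - d) ⟩
    entry [ c ] (k - d) + entry cs (k - d - + 1)     ≡⟨ cong₂ _+_ (sym (coeff-mkL [ c ] d k))
                                                                   (cong (entry cs) (shift-assoc k d)) ⟩
    coeff (mkL [ c ] d) k + entry cs (k - (d + + 1)) ≡⟨ cong₂ _+_ (coeff-singleton c d k) (sym (coeff-mkL cs (d + + 1) k)) ⟩
    c * coeff-q^ d k + coeff (mkL cs (d + + 1)) k    ∎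
    where
    shift-assoc : ∀ k d → k - d - + 1 ≡ k - (d + + 1)
    shift-assoc = solve-∀

  coeff-shift : ∀ cs d e k → coeff (mkL cs (d + e)) k ≡ coeff (mkL cs e) (k - d)
  coeff-shift cs d e k = begin
    coeff (mkL cs (d + e)) k ≡⟨ coeff-mkL cs (d + e) k ⟩
    entry cs (k - (d + e))   ≡⟨ cong (entry cs) (shift-assoc k d e) ⟩
    entry cs (k - d - e)     ≡⟨ sym (coeff-mkL cs e (k - d)) ⟩
    coeff (mkL cs e) (k - d) ∎
    where
    shift-assoc : ∀ k d e → k - (d + e) ≡ k - d - e
    shift-assoc = solve-∀

  coeff-shift-≡ : ∀ cs {d d'} k → d ≡ d' → coeff (mkL cs d) k ≡ coeff (mkL cs d') k
  coeff-shift-≡ cs k refl = refl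

  coeff-q^-swap : ∀ d e k → coeff-q^ e (k - d) ≡ coeff-q^ d (k - e)
  coeff-q^-swap d e k = begin
    coeff-q^ e (k - d)            ≡⟨ sym (coeff-shift [ + 1 ] d e k) ⟩
    coeff (mkL [ + 1 ] (d + e)) k ≡⟨ coeff-shift-≡ [ + 1 ] k (ℤ.+-comm d e) ⟩
    coeff (mkL [ + 1 ] (e + d)) k ≡⟨ coeff-shift [ + 1 ] e d k ⟩
    coeff-q^ d (k - e)            ∎

  -- The list operations of Defs are private; they are reached through _+L_ and
  -- _*L_ at shift 0.
  addCoeffs mulCoeffs : List ℤ → List ℤ → List ℤ
  addCoeffs xs ys = Laurent.coeffs (mkL xs (+ 0) +L mkL ys (+ 0))
  mulCoeffs xs ys = Laurent.coeffs (mkL xs (+ 0) *L mkL ys (+ 0))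

  padCoeffs : ℕ → List ℤ → List ℤ
  padCoeffs p cs = Laurent.coeffs (mkL [] (+ 0) +L mkL cs (+ p))

  coeff-addCoeffs : ∀ xs ys d k →
    coeff (mkL (addCoeffs xs ys) d) k ≡ coeff (mkL xs d) k + coeff (mkL ys d) k
  coeff-addCoeffs []       ys       d k = sym (trans (cong (_+ coeff (mkL ys d) k) (coeff-[] d k)) (ℤ.+-identityˡ _))
  coeff-addCoeffs (x ∷ xs) []       d k =
    sym (trans (cong (λ z → coeff (mkL (x ∷ xs) d) k + z) (coeff-[] d k)) (ℤ.+-identityʳ _))
  coeff-addCoeffs (x ∷ xs) (y ∷ ys) d k = begin
    coeff (mkL ((x + y) ∷ addCoeffs xs ys) d) k
      ≡⟨ coeff-∷ (x + y) (addCoeffs xs ys) d k ⟩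
    (x + y) * u + coeff (mkL (addCoeffs xs ys) d') k
      ≡⟨ cong (λ z → (x + y) * u + z) (coeff-addCoeffs xs ys d' k) ⟩
    (x + y) * u + (coeff (mkL xs d') k + coeff (mkL ys d') k)
      ≡⟨ regroup x y u (coeff (mkL xs d') k) (coeff (mkL ys d') k) ⟩
    (x * u + coeff (mkL xs d') k) + (y * u + coeff (mkL ys d') k)
      ≡⟨ cong₂ _+_ (sym (coeff-∷ x xs d k)) (sym (coeff-∷ y ys d k)) ⟩
    coeff (mkL (x ∷ xs) d) k + coeff (mkL (y ∷ ys) d) k ∎
    where
    u = coeff-q^ d k
    d' = d + + 1
    regroup : ∀ x y u a b → (x + y) * u + (a + b) ≡ (x * u + a) + (y * u + b)
    regroup = solve-∀

  coeff-padCoeffs : ∀ p cs d k → coeff (mkL (padCoeffs p cs) d) k ≡ coeff (mkL cs (d + + p)) k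
  coeff-padCoeffs zero    cs d k = coeff-shift-≡ cs k (sym (ℤ.+-identityʳ d))
  coeff-padCoeffs (suc p) cs d k = begin
    coeff (mkL (+ 0 ∷ padCoeffs p cs) d) k                 ≡⟨ coeff-∷ (+ 0) (padCoeffs p cs) d k ⟩
    + 0 * coeff-q^ d k + coeff (mkL (padCoeffs p cs) d') k ≡⟨ ℤ.+-identityˡ _ ⟩
    coeff (mkL (padCoeffs p cs) d') k                      ≡⟨ coeff-padCoeffs p cs d' k ⟩
    coeff (mkL cs (d' + + p)) k                            ≡⟨ coeff-shift-≡ cs k (ℤ.+-assoc d (+ 1) (+ p)) ⟩
    coeff (mkL cs (d + + suc p)) k                         ∎
    where d' = d + + 1

  coeff-+ : ∀ a b k → coeff (a +L b) k ≡ coeff a k + coeff b k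
  coeff-+ (mkL as d₁) (mkL bs d₂) k
    -- padCoeffs p unfolds to padding by p ℕ.+ 0; this puts the padding of _+L_ in that form
    rewrite sym (ℕ.+-identityʳ ℤ.∣ d₁ - d₁ ℤ.⊓ d₂ ∣) | sym (ℕ.+-identityʳ ℤ.∣ d₂ - d₁ ℤ.⊓ d₂ ∣) = begin
    coeff (mkL (addCoeffs (padCoeffs p₁ as) (padCoeffs p₂ bs)) m) k
      ≡⟨ coeff-addCoeffs (padCoeffs p₁ as) (padCoeffs p₂ bs) m k ⟩
    coeff (mkL (padCoeffs p₁ as) m) k + coeff (mkL (padCoeffs p₂ bs) m) k
      ≡⟨ cong₂ _+_ (coeff-padCoeffs p₁ as m k) (coeff-padCoeffs p₂ bs m k) ⟩
    coeff (mkL as (m + + p₁)) k + coeff (mkL bs (m + + p₂)) k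
      ≡⟨ cong₂ _+_ (coeff-shift-≡ as k (unpad (ℤ.i⊓j≤i d₁ d₂))) (coeff-shift-≡ bs k (unpad (ℤ.i⊓j≤j d₁ d₂))) ⟩
    coeff (mkL as d₁) k + coeff (mkL bs d₂) k ∎
    where
    m = d₁ ℤ.⊓ d₂
    p₁ = ℤ.∣ d₁ - m ∣
    p₂ = ℤ.∣ d₂ - m ∣
    unpad : ∀ {d} → m ℤ.≤ d → m + + ℤ.∣ d - m ∣ ≡ d
    unpad {d} m≤d = trans (cong (λ z → m + z) (ℤ.0≤i⇒+∣i∣≡i (ℤ.i≤j⇒0≤j-i m≤d))) (cancel m d)
      where
      cancel : ∀ m d → m + (d - m) ≡ d
      cancel = solve-∀

  coeff-neg : ∀ a k → coeff (-L a) k ≡ - coeff a k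
  coeff-neg (mkL as d) k = go as d
    where
    go : ∀ as d → coeff (mkL (map -_ as) d) k ≡ - coeff (mkL as d) k
    go []       d = trans (coeff-[] d k) (cong -_ (sym (coeff-[] d k)))
    go (x ∷ xs) d = begin
      coeff (mkL (- x ∷ map -_ xs) d) k                        ≡⟨ coeff-∷ (- x) (map -_ xs) d k ⟩
      - x * coeff-q^ d k + coeff (mkL (map -_ xs) (d + + 1)) k ≡⟨ cong (λ z → - x * coeff-q^ d k + z) (go xs (d + + 1)) ⟩
      - x * coeff-q^ d k + - coeff (mkL xs (d + + 1)) k        ≡⟨ negate x (coeff-q^ d k) _ ⟩
      - (x * coeff-q^ d k + coeff (mkL xs (d + + 1)) k)        ≡⟨ cong -_ (sym (coeff-∷ x xs d k)) ⟩
      - coeff (mkL (x ∷ xs) d) k                               ∎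
      where
      negate : ∀ x u a → - x * u + - a ≡ - (x * u + a)
      negate = solve-∀

  coeff-*-[]ˡ : ∀ d b k → coeff (mkL [] d *L b) k ≡ + 0
  coeff-*-[]ˡ d (mkL bs e) k = coeff-[] (d + e) k

  coeff-map-* : ∀ x ys d k → coeff (mkL (map (x *_) ys) d) k ≡ x * coeff (mkL ys d) k
  coeff-map-* x []       d k = trans (coeff-[] d k) (sym (trans (cong (x *_) (coeff-[] d k)) (ℤ.*-zeroʳ x)))
  coeff-map-* x (y ∷ ys) d k = begin
    coeff (mkL (x * y ∷ map (x *_) ys) d) k             ≡⟨ coeff-∷ (x * y) _ d k ⟩
    x * y * u + coeff (mkL (map (x *_) ys) (d + + 1)) k ≡⟨ cong (λ z → x * y * u + z) (coeff-map-* x ys (d + + 1) k) ⟩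
    x * y * u + x * coeff (mkL ys (d + + 1)) k          ≡⟨ factor x y u _ ⟩
    x * (y * u + coeff (mkL ys (d + + 1)) k)            ≡⟨ cong (x *_) (sym (coeff-∷ y ys d k)) ⟩
    x * coeff (mkL (y ∷ ys) d) k                        ∎
    where
    u = coeff-q^ d k
    factor : ∀ x y u a → x * y * u + x * a ≡ x * (y * u + a)
    factor = solve-∀

  coeff-*-∷ˡ : ∀ x xs d b k →
    coeff (mkL (x ∷ xs) d *L b) k ≡ x * coeff b (k - d) + coeff (mkL xs (d + + 1) *L b) k
  coeff-*-∷ˡ x xs d (mkL bs e) k = begin
    coeff (mkL (addCoeffs (map (x *_) bs) (+ 0 ∷ mulCoeffs xs bs)) (d + e)) k
      ≡⟨ coeff-addCoeffs (map (x *_) bs) (+ 0 ∷ mulCoeffs xs bs) (d + e) k ⟩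
    coeff (mkL (map (x *_) bs) (d + e)) k + coeff (mkL (+ 0 ∷ mulCoeffs xs bs) (d + e)) k
      ≡⟨ cong₂ _+_ (coeff-map-* x bs (d + e) k) (coeff-∷ (+ 0) (mulCoeffs xs bs) (d + e) k) ⟩
    x * coeff (mkL bs (d + e)) k + (+ 0 * coeff-q^ (d + e) k + coeff (mkL (mulCoeffs xs bs) (d + e + + 1)) k)
      ≡⟨ cong₂ (λ u v → x * u + v) (coeff-shift bs d e k)
           (trans (ℤ.+-identityˡ _) (coeff-shift-≡ (mulCoeffs xs bs) k (swap d e))) ⟩
    x * coeff (mkL bs e) (k - d) + coeff (mkL (mulCoeffs xs bs) (d + + 1 + e)) k ∎
    where
    swap : ∀ d e → d + e + + 1 ≡ d + + 1 + e
    swap = solve-∀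

  coeff-singleton-* : ∀ x d b k → coeff (mkL [ x ] d *L b) k ≡ x * coeff b (k - d)
  coeff-singleton-* x d b k = begin
    coeff (mkL [ x ] d *L b) k                            ≡⟨ coeff-*-∷ˡ x [] d b k ⟩
    x * coeff b (k - d) + coeff (mkL [] (d + + 1) *L b) k ≡⟨ cong (λ z → x * coeff b (k - d) + z) (coeff-*-[]ˡ (d + + 1) b k) ⟩
    x * coeff b (k - d) + + 0                             ≡⟨ ℤ.+-identityʳ _ ⟩
    x * coeff b (k - d)                                   ∎

  *-congˡ : ∀ a {b b'} → b ≈L b' → a *L b ≈L a *L b'
  *-congˡ (mkL xs d) {b} {b'} b≈b' = go xs d
    where
    go : ∀ xs d → mkL xs d *L b ≈L mkL xs d *L b'
    go []       d k = trans (coeff-*-[]ˡ d b k) (sym (coeff-*-[]ˡ d b' k))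
    go (x ∷ xs) d k = begin
      coeff (mkL (x ∷ xs) d *L b) k                           ≡⟨ coeff-*-∷ˡ x xs d b k ⟩
      x * coeff b (k - d) + coeff (mkL xs (d + + 1) *L b) k   ≡⟨ cong₂ (λ u v → x * u + v) (b≈b' (k - d)) (go xs (d + + 1) k) ⟩
      x * coeff b' (k - d) + coeff (mkL xs (d + + 1) *L b') k ≡⟨ sym (coeff-*-∷ˡ x xs d b' k) ⟩
      coeff (mkL (x ∷ xs) d *L b') k                          ∎

  coeff-*-[]ʳ : ∀ a d k → coeff (a *L mkL [] d) k ≡ + 0
  coeff-*-[]ʳ (mkL xs e) d k = go xs e
    where
    go : ∀ xs e → coeff (mkL xs e *L mkL [] d) k ≡ + 0
    go []       e = coeff-*-[]ˡ e (mkL [] d) k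
    go (x ∷ xs) e = begin
      coeff (mkL (x ∷ xs) e *L mkL [] d) k                                  ≡⟨ coeff-*-∷ˡ x xs e (mkL [] d) k ⟩
      x * coeff (mkL [] d) (k - e) + coeff (mkL xs (e + + 1) *L mkL [] d) k ≡⟨ cong₂ (λ u v → x * u + v) (coeff-[] d (k - e)) (go xs (e + + 1)) ⟩
      x * + 0 + + 0                                                         ≡⟨ cong (_+ + 0) (ℤ.*-zeroʳ x) ⟩
      + 0                                                                   ∎

  coeff-*-∷ʳ : ∀ a y ys e k →
    coeff (a *L mkL (y ∷ ys) e) k ≡ y * coeff a (k - e) + coeff (a *L mkL ys (e + + 1)) k
  coeff-*-∷ʳ (mkL xs d) y ys e k = go xs d
    where
    B = mkL (y ∷ ys) e
    B' = mkL ys (e + + 1)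
    go : ∀ xs d → coeff (mkL xs d *L B) k ≡ y * coeff (mkL xs d) (k - e) + coeff (mkL xs d *L B') k
    go [] d = begin
      coeff (mkL [] d *L B) k                                 ≡⟨ coeff-*-[]ˡ d B k ⟩
      + 0                                                     ≡⟨ zero-sum y ⟩
      y * + 0 + + 0                                           ≡⟨ cong₂ (λ u v → y * u + v) (sym (coeff-[] d (k - e)))
                                                                                          (sym (coeff-*-[]ˡ d B' k)) ⟩
      y * coeff (mkL [] d) (k - e) + coeff (mkL [] d *L B') k ∎
      where
      zero-sum : ∀ y → + 0 ≡ y * + 0 + + 0
      zero-sum = solve-∀
    go (x ∷ xs) d = begin
      coeff (mkL (x ∷ xs) d *L B) k
        ≡⟨ coeff-*-∷ˡ x xs d B k ⟩
      x * coeff B (k - d) + coeff (A' *L B) k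
        ≡⟨ cong₂ (λ u v → x * u + v) (coeff-∷ y ys e (k - d)) (go xs (d + + 1)) ⟩
      x * (y * coeff-q^ e (k - d) + coeff B' (k - d)) + (y * coeff A' (k - e) + coeff (A' *L B') k)
        ≡⟨ cong (λ z → x * (y * z + coeff B' (k - d)) + (y * coeff A' (k - e) + coeff (A' *L B') k)) (coeff-q^-swap d e k) ⟩
      x * (y * coeff-q^ d (k - e) + coeff B' (k - d)) + (y * coeff A' (k - e) + coeff (A' *L B') k)
        ≡⟨ exchange x y (coeff-q^ d (k - e)) (coeff B' (k - d)) (coeff A' (k - e)) (coeff (A' *L B') k) ⟩
      y * (x * coeff-q^ d (k - e) + coeff A' (k - e)) + (x * coeff B' (k - d) + coeff (A' *L B') k)
        ≡⟨ cong₂ (λ u v → y * u + v) (sym (coeff-∷ x xs d (k - e))) (sym (coeff-*-∷ˡ x xs d B' k)) ⟩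
      y * coeff (mkL (x ∷ xs) d) (k - e) + coeff (mkL (x ∷ xs) d *L B') k ∎
      where
      A' = mkL xs (d + + 1)
      exchange : ∀ x y u b a r → x * (y * u + b) + (y * a + r) ≡ y * (x * u + a) + (x * b + r)
      exchange = solve-∀

  *-comm : ∀ a b → a *L b ≈L b *L a
  *-comm (mkL xs d) b = go xs d
    where
    go : ∀ xs d → mkL xs d *L b ≈L b *L mkL xs d
    go []       d k = trans (coeff-*-[]ˡ d b k) (sym (coeff-*-[]ʳ b d k))
    go (x ∷ xs) d k = begin
      coeff (mkL (x ∷ xs) d *L b) k                         ≡⟨ coeff-*-∷ˡ x xs d b k ⟩
      x * coeff b (k - d) + coeff (mkL xs (d + + 1) *L b) k ≡⟨ cong (λ z → x * coeff b (k - d) + z) (go xs (d + + 1) k) ⟩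
      x * coeff b (k - d) + coeff (b *L mkL xs (d + + 1)) k ≡⟨ sym (coeff-*-∷ʳ b x xs d k) ⟩
      coeff (b *L mkL (x ∷ xs) d) k                         ∎

  *-congʳ : ∀ {a a'} b → a ≈L a' → a *L b ≈L a' *L b
  *-congʳ {a} {a'} b a≈a' k = trans (*-comm a b k) (trans (*-congˡ b a≈a' k) (*-comm b a' k))

  coeff-*-+ : ∀ c a b k → coeff (c *L (a +L b)) k ≡ coeff (c *L a) k + coeff (c *L b) k
  coeff-*-+ (mkL zs f) a b k = go zs f
    where
    go : ∀ zs f → coeff (mkL zs f *L (a +L b)) k ≡ coeff (mkL zs f *L a) k + coeff (mkL zs f *L b) k
    go []       f = begin
      coeff (mkL [] f *L (a +L b)) k                    ≡⟨ coeff-*-[]ˡ f (a +L b) k ⟩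
      + 0                                               ≡⟨ sym (cong₂ _+_ (coeff-*-[]ˡ f a k) (coeff-*-[]ˡ f b k)) ⟩
      coeff (mkL [] f *L a) k + coeff (mkL [] f *L b) k ∎
    go (z ∷ zs) f = begin
      coeff (mkL (z ∷ zs) f *L (a +L b)) k
        ≡⟨ coeff-*-∷ˡ z zs f (a +L b) k ⟩
      z * coeff (a +L b) (k - f) + coeff (C' *L (a +L b)) k
        ≡⟨ cong₂ (λ u v → z * u + v) (coeff-+ a b (k - f)) (go zs (f + + 1)) ⟩
      z * (coeff a (k - f) + coeff b (k - f)) + (coeff (C' *L a) k + coeff (C' *L b) k)
        ≡⟨ regroup z (coeff a (k - f)) (coeff b (k - f)) (coeff (C' *L a) k) (coeff (C' *L b) k) ⟩
      (z * coeff a (k - f) + coeff (C' *L a) k) + (z * coeff b (k - f) + coeff (C' *L b) k)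
        ≡⟨ cong₂ _+_ (sym (coeff-*-∷ˡ z zs f a k)) (sym (coeff-*-∷ˡ z zs f b k)) ⟩
      coeff (mkL (z ∷ zs) f *L a) k + coeff (mkL (z ∷ zs) f *L b) k ∎
      where
      C' = mkL zs (f + + 1)
      regroup : ∀ z u v a b → z * (u + v) + (a + b) ≡ (z * u + a) + (z * v + b)
      regroup = solve-∀

  *-distribˡ-+ : ∀ c a b → c *L (a +L b) ≈L c *L a +L c *L b
  *-distribˡ-+ c a b k = trans (coeff-*-+ c a b k) (sym (coeff-+ (c *L a) (c *L b) k))

  *-distribʳ-+ : ∀ c a b → (a +L b) *L c ≈L a *L c +L b *L c
  *-distribʳ-+ c a b k = begin
    coeff ((a +L b) *L c) k             ≡⟨ *-comm (a +L b) c k ⟩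
    coeff (c *L (a +L b)) k             ≡⟨ coeff-*-+ c a b k ⟩
    coeff (c *L a) k + coeff (c *L b) k ≡⟨ cong₂ _+_ (*-comm c a k) (*-comm c b k) ⟩
    coeff (a *L c) k + coeff (b *L c) k ≡⟨ sym (coeff-+ (a *L c) (b *L c) k) ⟩
    coeff (a *L c +L b *L c) k          ∎

  coeff-singleton-*-* : ∀ x d b c k → coeff ((mkL [ x ] d *L b) *L c) k ≡ x * coeff (b *L c) (k - d)
  coeff-singleton-*-* x d b (mkL zs f) = go zs f
    where
    xb = mkL [ x ] d *L b
    go : ∀ zs f k → coeff (xb *L mkL zs f) k ≡ x * coeff (b *L mkL zs f) (k - d)
    go []       f k = begin
      coeff (xb *L mkL [] f) k          ≡⟨ coeff-*-[]ʳ xb f k ⟩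
      + 0                               ≡⟨ sym (ℤ.*-zeroʳ x) ⟩
      x * + 0                           ≡⟨ cong (x *_) (sym (coeff-*-[]ʳ b f (k - d))) ⟩
      x * coeff (b *L mkL [] f) (k - d) ∎
    go (z ∷ zs) f k = begin
      coeff (xb *L mkL (z ∷ zs) f) k
        ≡⟨ coeff-*-∷ʳ xb z zs f k ⟩
      z * coeff xb (k - f) + coeff (xb *L C') k
        ≡⟨ cong₂ (λ u v → z * u + v) (coeff-singleton-* x d b (k - f)) (go zs (f + + 1) k) ⟩
      z * (x * coeff b (k - f - d)) + x * coeff (b *L C') (k - d)
        ≡⟨ cong (λ j → z * (x * coeff b j) + x * coeff (b *L C') (k - d)) (shifts-commute k f d) ⟩
      z * (x * coeff b (k - d - f)) + x * coeff (b *L C') (k - d)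
        ≡⟨ factor z x (coeff b (k - d - f)) (coeff (b *L C') (k - d)) ⟩
      x * (z * coeff b (k - d - f) + coeff (b *L C') (k - d))
        ≡⟨ cong (x *_) (sym (coeff-*-∷ʳ b z zs f (k - d))) ⟩
      x * coeff (b *L mkL (z ∷ zs) f) (k - d) ∎
      where
      C' = mkL zs (f + + 1)
      shifts-commute : ∀ k f d → k - f - d ≡ k - d - f
      shifts-commute = solve-∀
      factor : ∀ z x u w → z * (x * u) + x * w ≡ x * (z * u + w)
      factor = solve-∀

  mkL-∷ : ∀ x xs d → mkL (x ∷ xs) d ≈L mkL [ x ] d +L mkL xs (d + + 1)
  mkL-∷ x xs d k = begin
    coeff (mkL (x ∷ xs) d) k                           ≡⟨ coeff-∷ x xs d k ⟩
    x * coeff-q^ d k + coeff (mkL xs (d + + 1)) k      ≡⟨ cong (_+ coeff (mkL xs (d + + 1)) k) (sym (coeff-singleton x d k)) ⟩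
    coeff (mkL [ x ] d) k + coeff (mkL xs (d + + 1)) k ≡⟨ sym (coeff-+ (mkL [ x ] d) (mkL xs (d + + 1)) k) ⟩
    coeff (mkL [ x ] d +L mkL xs (d + + 1)) k          ∎

  *-assoc : ∀ a b c → (a *L b) *L c ≈L a *L (b *L c)
  *-assoc (mkL xs d) b c = go xs d
    where
    go : ∀ xs d → (mkL xs d *L b) *L c ≈L mkL xs d *L (b *L c)
    go [] d k = begin
      coeff ((mkL [] d *L b) *L c) k ≡⟨ coeff-*-[]ˡ (d + Laurent.shift b) c k ⟩
      + 0                            ≡⟨ sym (coeff-*-[]ˡ d (b *L c) k) ⟩
      coeff (mkL [] d *L (b *L c)) k ∎
    go (x ∷ xs) d k = begin
      coeff ((mkL (x ∷ xs) d *L b) *L c) k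
        ≡⟨ *-congʳ c (*-congʳ b (mkL-∷ x xs d)) k ⟩
      coeff (((X +L A') *L b) *L c) k
        ≡⟨ *-congʳ c (*-distribʳ-+ b X A') k ⟩
      coeff ((X *L b +L A' *L b) *L c) k
        ≡⟨ trans (*-distribʳ-+ c (X *L b) (A' *L b) k) (coeff-+ ((X *L b) *L c) ((A' *L b) *L c) k) ⟩
      coeff ((X *L b) *L c) k + coeff ((A' *L b) *L c) k
        ≡⟨ cong₂ _+_ (coeff-singleton-*-* x d b c k) (go xs (d + + 1) k) ⟩
      x * coeff (b *L c) (k - d) + coeff (A' *L (b *L c)) k
        ≡⟨ sym (coeff-*-∷ˡ x xs d (b *L c) k) ⟩
      coeff (mkL (x ∷ xs) d *L (b *L c)) k ∎
      where
      X = mkL [ x ] d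
      A' = mkL xs (d + + 1)

  *-identityˡ : ∀ a → 1L *L a ≈L a
  *-identityˡ a k = begin
    coeff (1L *L a) k       ≡⟨ coeff-singleton-* (+ 1) (+ 0) a k ⟩
    + 1 * coeff a (k - + 0) ≡⟨ ℤ.*-identityˡ _ ⟩
    coeff a (k - + 0)       ≡⟨ cong (coeff a) (ℤ.+-identityʳ k) ⟩
    coeff a k               ∎

  infix 4 _≋_

  -- _≈L_ unfolds to a Π-type from which Agda cannot recover the two
  -- polynomials; this wrapper is injective in them.
  record _≋_ (a b : Laurent) : Set where
    constructor coeffwise
    field ≋⇒≈L : a ≈L b
  open _≋_ public

  coeff-0L : ∀ k → coeff 0L k ≡ + 0
  coeff-0L = coeff-[] (+ 0)

  isCommutativeRing : IsCommutativeRing _≋_ _+L_ _*L_ -L_ 0L 1L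
  isCommutativeRing = record
    { isRing = record
      { +-isAbelianGroup = record
        { isGroup = record
          { isMonoid = record
            { isSemigroup = record
              { isMagma = record
                { isEquivalence = record
                  { refl  = coeffwise λ k → refl
                  ; sym   = λ (coeffwise p) → coeffwise λ k → sym (p k)
                  ; trans = λ (coeffwise p) (coeffwise q) → coeffwise λ k → trans (p k) (q k) }
                ; ∙-cong = λ {a} {a'} {b} {b'} (coeffwise p) (coeffwise q) → coeffwise λ k →
                    trans-via (coeff-+ a b k) (cong₂ _+_ (p k) (q k)) (coeff-+ a' b' k) }
              ; assoc = λ a b c → coeffwise λ k → begin
                  coeff ((a +L b) +L c) k             ≡⟨ trans (coeff-+ (a +L b) c k) (cong (_+ coeff c k) (coeff-+ a b k)) ⟩
                  coeff a k + coeff b k + coeff c k   ≡⟨ ℤ.+-assoc (coeff a k) (coeff b k) (coeff c k) ⟩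
                  coeff a k + (coeff b k + coeff c k) ≡⟨ sym (trans (coeff-+ a (b +L c) k) (cong (λ z → coeff a k + z) (coeff-+ b c k))) ⟩
                  coeff (a +L (b +L c)) k             ∎ }
            ; identity =
                (λ a → coeffwise λ k → trans (coeff-+ 0L a k) (trans (cong (_+ coeff a k) (coeff-0L k)) (ℤ.+-identityˡ _)))
              , (λ a → coeffwise λ k → trans (coeff-+ a 0L k) (trans (cong (λ z → coeff a k + z) (coeff-0L k)) (ℤ.+-identityʳ _))) }
          ; inverse =
              (λ a → coeffwise λ k → trans-via (coeff-+ (-L a) a k) (trans (cong (_+ coeff a k) (coeff-neg a k)) (ℤ.+-inverseˡ (coeff a k))) (coeff-0L k))
            , (λ a → coeffwise λ k → trans-via (coeff-+ a (-L a) k) (trans (cong (λ z → coeff a k + z) (coeff-neg a k)) (ℤ.+-inverseʳ (coeff a k))) (coeff-0L k))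
          ; ⁻¹-cong = λ {a} {a'} (coeffwise p) → coeffwise λ k → trans-via (coeff-neg a k) (cong -_ (p k)) (coeff-neg a' k) }
        ; comm = λ a b → coeffwise λ k → trans-via (coeff-+ a b k) (ℤ.+-comm (coeff a k) (coeff b k)) (coeff-+ b a k) }
      ; *-cong = λ {a} {a'} {b} (coeffwise p) (coeffwise q) → coeffwise λ k → trans (*-congʳ b p k) (*-congˡ a' q k)
      ; *-assoc = λ a b c → coeffwise (*-assoc a b c)
      ; *-identity = (λ a → coeffwise (*-identityˡ a)) , (λ a → coeffwise λ k → trans (*-comm a 1L k) (*-identityˡ a k))
      ; distrib = (λ c a b → coeffwise (*-distribˡ-+ c a b)) , (λ c a b → coeffwise (*-distribʳ-+ c a b)) }
    ; *-comm = λ a b → coeffwise (*-comm a b) }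
    where
    trans-via : ∀ {x y u v : ℤ} → x ≡ u → u ≡ v → y ≡ v → x ≡ y
    trans-via p q r = trans p (trans q (sym r))

  commutativeRing : CommutativeRing 0ℓ 0ℓ
  commutativeRing = record { isCommutativeRing = isCommutativeRing }

  almostCommutativeRing : AlmostCommutativeRing 0ℓ 0ℓ
  almostCommutativeRing = fromCommutativeRing commutativeRing (λ _ → nothing)

module CoxeterGroup (CS : CoxeterSystem) where

  open CoxeterSystem CS hiding (_⁻¹)
  open import Level using (0ℓ)
  open import Algebra.Bundles using (Group)
  open import Data.Bool using (Bool; true; false; _xor_)
  import Data.Bool.Properties as Bool
  open import Data.Empty using (⊥-elim)
  open import Data.List using ([]; _∷_; _++_; _∷ʳ_; [_]; length; map)
  import Data.List.Properties as List
  open import Data.Nat as ℕ using (ℕ; zero; suc; _≤_; _<_; s≤s; parity)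
  import Data.Nat.Properties as ℕ
  open import Data.Parity.Base using (Parity; 0ℙ; 1ℙ; _⁻¹) renaming (_+_ to _+ℙ_)
  import Data.Parity.Properties as Parity
  open import Data.Product using (Σ; _×_; proj₁; proj₂)
  open import Data.Sum using (_⊎_; inj₁; inj₂)
  open import Relation.Nullary using (yes; no; does)
  open import Relation.Binary.Definitions using (tri<; tri≈; tri>)
  open import Relation.Binary.PropositionalEquality hiding ([_])
  open import Tactic.MonoidSolver using (solve)
  open Permutations
  open ≡-Reasoning

  ⟦_⟧ : List (Fin rank) → W
  ⟦_⟧ = evalWord e _·_ s

  W-monoid : Monoid 0ℓ 0ℓ
  W-monoid = record
    { Carrier = W ; _≈_ = _≡_ ; _∙_ = _·_ ; ε = e
    ; isMonoid = record
      { isSemigroup = record { isMagma = record { isEquivalence = isEquivalence ; ∙-cong = cong₂ _·_ } ; assoc = assoc }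
      ; identity = idˡ , idʳ } }

  s-involutive : ∀ i → s i · s i ≡ e
  s-involutive i = begin
    s i · s i                      ≡⟨ sym (idʳ _) ⟩
    mpow e _·_ (s i · s i) 1       ≡⟨ cong (mpow e _·_ (s i · s i)) (sym (m-diag i)) ⟩
    mpow e _·_ (s i · s i) (m i i) ≡⟨ relations i i ⟩
    e                              ∎

  s-cancelˡ : ∀ i x → s i · (s i · x) ≡ x
  s-cancelˡ i x = trans (sym (assoc _ _ _)) (trans (cong (_· x) (s-involutive i)) (idˡ x))

  s-cancelʳ : ∀ i x → (x · s i) · s i ≡ x
  s-cancelʳ i x = trans (assoc _ _ _) (trans (cong (x ·_) (s-involutive i)) (idʳ x))

  ⟦⟧-++ : ∀ xs ys → ⟦ xs ++ ys ⟧ ≡ ⟦ xs ⟧ · ⟦ ys ⟧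
  ⟦⟧-++ []       ys = sym (idˡ _)
  ⟦⟧-++ (x ∷ xs) ys = trans (cong (s x ·_) (⟦⟧-++ xs ys)) (sym (assoc _ _ _))

  ⟦⟧-∷ʳ : ∀ xs i → ⟦ xs ∷ʳ i ⟧ ≡ ⟦ xs ⟧ · s i
  ⟦⟧-∷ʳ xs i = trans (⟦⟧-++ xs [ i ]) (cong (⟦ xs ⟧ ·_) (idʳ (s i)))

  ℓ-⟦⟧ : ∀ w → ℓ ⟦ w ⟧ ≤ length w
  ℓ-⟦⟧ w = ℓ-min ⟦ w ⟧ w refl

  ℓ-e : ℓ e ≡ 0
  ℓ-e = ℕ.n≤0⇒n≡0 (ℓ-⟦⟧ [])

  red-e : red e ≡ []
  red-e with red e | red-len e
  ... | []    | _  = refl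
  ... | _ ∷ _ | eq = ⊥-elim (ℕ.1+n≢0 (trans eq ℓ-e))

  ℓ-· : ∀ x y → ℓ (x · y) ≤ ℓ x ℕ.+ ℓ y
  ℓ-· x y = ℕ.≤-trans (ℓ-min (x · y) (red x ++ red y) ⟦red-x++red-y⟧)
                      (ℕ.≤-reflexive (trans (List.length-++ (red x)) (cong₂ ℕ._+_ (red-len x) (red-len y))))
    where
    ⟦red-x++red-y⟧ : ⟦ red x ++ red y ⟧ ≡ x · y
    ⟦red-x++red-y⟧ = trans (⟦⟧-++ (red x) (red y)) (cong₂ _·_ (red-eval x) (red-eval y))

  ℓ-s· : ∀ i x → ℓ (s i · x) ≤ suc (ℓ x)
  ℓ-s· i x = ℕ.≤-trans (ℓ-min (s i · x) (i ∷ red x) (cong (s i ·_) (red-eval x)))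
                       (ℕ.≤-reflexive (cong suc (red-len x)))

  ℓ-·s : ∀ i x → ℓ (x · s i) ≤ suc (ℓ x)
  ℓ-·s i x = ℕ.≤-trans (ℓ-min (x · s i) (red x ∷ʳ i) (trans (⟦⟧-∷ʳ (red x) i) (cong (_· s i) (red-eval x))))
                       (ℕ.≤-reflexive (trans (List.length-++ (red x)) (trans (cong (ℕ._+ 1) (red-len x)) (ℕ.+-comm (ℓ x) 1))))

  0ℙ-pow : ∀ k → gpow Parity.+-0-group 0ℙ k ≡ 0ℙ
  0ℙ-pow zero    = refl
  0ℙ-pow (suc k) = 0ℙ-pow k

  signHom : Σ (W → Parity) λ φ → (∀ x y → φ (x · y) ≡ φ x +ℙ φ y) × (∀ i → φ (s i) ≡ 1ℙ)
  signHom = universal Parity.+-0-group (λ _ → 1ℙ) (λ i j → 0ℙ-pow (m i j))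

  sign : W → Parity
  sign = proj₁ signHom

  sign-· : ∀ x y → sign (x · y) ≡ sign x +ℙ sign y
  sign-· = proj₁ (proj₂ signHom)

  sign-s : ∀ i → sign (s i) ≡ 1ℙ
  sign-s = proj₂ (proj₂ signHom)

  sign-e : sign e ≡ 0ℙ
  sign-e = idempotent⇒0ℙ (sym (trans (cong sign (sym (idˡ e))) (sign-· e e)))
    where
    idempotent⇒0ℙ : ∀ {p} → p +ℙ p ≡ p → p ≡ 0ℙ
    idempotent⇒0ℙ {0ℙ} _ = refl
    idempotent⇒0ℙ {1ℙ} ()

  sign-⟦⟧ : ∀ w → sign ⟦ w ⟧ ≡ parity (length w)
  sign-⟦⟧ []      = sign-e
  sign-⟦⟧ (i ∷ w) = begin
    sign (s i · ⟦ w ⟧)       ≡⟨ sign-· (s i) ⟦ w ⟧ ⟩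
    sign (s i) +ℙ sign ⟦ w ⟧ ≡⟨ cong₂ _+ℙ_ (sign-s i) (sign-⟦⟧ w) ⟩
    1ℙ +ℙ parity (length w)  ≡⟨ sym (Parity.+-homo-+ 1 (length w)) ⟩
    parity (suc (length w))  ∎

  sign-ℓ : ∀ x → sign x ≡ parity (ℓ x)
  sign-ℓ x = begin
    sign x                  ≡⟨ cong sign (sym (red-eval x)) ⟩
    sign ⟦ red x ⟧          ≡⟨ sign-⟦⟧ (red x) ⟩
    parity (length (red x)) ≡⟨ cong parity (red-len x) ⟩
    parity (ℓ x)            ∎

  ℓ-≢-of-sign⁻¹ : ∀ {x y} → sign y ≡ sign x ⁻¹ → ℓ y ≢ ℓ x
  ℓ-≢-of-sign⁻¹ {x} {y} sy≡sx⁻¹ ℓy≡ℓx = Parity.p≢p⁻¹ (sign x) (begin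
    sign x       ≡⟨ sign-ℓ x ⟩
    parity (ℓ x) ≡⟨ cong parity (sym ℓy≡ℓx) ⟩
    parity (ℓ y) ≡⟨ sym (sign-ℓ y) ⟩
    sign y       ≡⟨ sy≡sx⁻¹ ⟩
    sign x ⁻¹    ∎)

  ℓ-s·≢ : ∀ i x → ℓ (s i · x) ≢ ℓ x
  ℓ-s·≢ i x = ℓ-≢-of-sign⁻¹ (trans (sign-· (s i) x) (cong (_+ℙ sign x) (sign-s i)))

  ℓ-·s≢ : ∀ i x → ℓ (x · s i) ≢ ℓ x
  ℓ-·s≢ i x = ℓ-≢-of-sign⁻¹ (trans (sign-· x (s i)) (trans (cong (sign x +ℙ_) (sign-s i)) (Parity.+-comm (sign x) 1ℙ)))

  adjacent : ∀ {a b} → a ≤ suc b → b ≤ suc a → a ≢ b → a ≡ suc b ⊎ b ≡ suc a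
  adjacent {a} {b} a≤1+b b≤1+a a≢b with ℕ.<-cmp a b
  ... | tri< a<b _   _   = inj₂ (ℕ.≤-antisym b≤1+a a<b)
  ... | tri≈ _   a≡b _   = ⊥-elim (a≢b a≡b)
  ... | tri> _   _   b<a = inj₁ (ℕ.≤-antisym a≤1+b b<a)

  ℓ-s·-cases : ∀ i x → ℓ (s i · x) ≡ suc (ℓ x) ⊎ ℓ x ≡ suc (ℓ (s i · x))
  ℓ-s·-cases i x = adjacent (ℓ-s· i x) (subst (λ z → ℓ z ≤ suc (ℓ (s i · x))) (s-cancelˡ i x) (ℓ-s· i (s i · x))) (ℓ-s·≢ i x)

  ℓ-·s-cases : ∀ i x → ℓ (x · s i) ≡ suc (ℓ x) ⊎ ℓ x ≡ suc (ℓ (x · s i))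
  ℓ-·s-cases i x = adjacent (ℓ-·s i x) (subst (λ z → ℓ z ≤ suc (ℓ (x · s i))) (s-cancelʳ i x) (ℓ-·s i (x · s i))) (ℓ-·s≢ i x)

  ℓ-s : ∀ i → ℓ (s i) ≡ 1
  ℓ-s i with ℓ-·s-cases i e
  ... | inj₁ ℓs≡1+ℓe = trans (cong ℓ (sym (idˡ (s i)))) (trans ℓs≡1+ℓe (cong suc ℓ-e))
  ... | inj₂ ℓe≡1+ℓs = ⊥-elim (ℕ.1+n≢0 (trans (sym ℓe≡1+ℓs) ℓ-e))

  red-s : ∀ i → Σ (Fin rank) λ j → red (s i) ≡ [ j ] × s j ≡ s i
  red-s i with red (s i) | red-len (s i) | red-eval (s i)
  ... | []         | len | _   = ⊥-elim (ℕ.1+n≢0 (sym (trans len (ℓ-s i))))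
  ... | j ∷ []     | _   | ⟦j⟧ = j , refl , trans (sym (idʳ (s j))) ⟦j⟧
  ... | _ ∷ _ ∷ _  | len | _   = ⊥-elim (ℕ.1+n≢0 (ℕ.suc-injective (trans len (ℓ-s i))))

  -- Tits' cocycle

  conj : Fin rank → W → W
  conj i r = s i · (r · s i)

  conj-involutive : ∀ i r → conj i (conj i r) ≡ r
  conj-involutive i r = begin
    s i · ((s i · (r · s i)) · s i) ≡⟨ cong (s i ·_) (solve W-monoid) ⟩
    s i · (s i · ((r · s i) · s i)) ≡⟨ s-cancelˡ i _ ⟩
    (r · s i) · s i                 ≡⟨ s-cancelʳ i r ⟩
    r                               ∎

  conj-s : ∀ i → conj i (s i) ≡ s i
  conj-s i = trans (cong (s i ·_) (s-involutive i)) (idʳ (s i))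

  infix 4 _==_
  _==_ : W → W → Bool
  x == y = does (x ≟ y)

  ==-refl : ∀ x → (x == x) ≡ true
  ==-refl x with x ≟ x
  ... | yes _  = refl
  ... | no x≢x = ⊥-elim (x≢x refl)

  ==⇒≡ : ∀ {x y} → (x == y) ≡ true → x ≡ y
  ==⇒≡ {x} {y} eq with x ≟ y
  ... | yes x≡y = x≡y

  ≢⇒==-false : ∀ {x y} → x ≢ y → (x == y) ≡ false
  ≢⇒==-false {x} {y} x≢y with x ≟ y
  ... | yes x≡y = ⊥-elim (x≢y x≡y)
  ... | no _    = refl

  ==-conj : ∀ i r x → (conj i r == x) ≡ (r == conj i x)
  ==-conj i r x with r ≟ conj i x
  ... | yes refl = trans (cong (_== x) (conj-involutive i x)) (==-refl x)
  ... | no r≢    = ≢⇒==-false (λ eq → r≢ (trans (sym (conj-involutive i r)) (cong (conj i) eq)))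

  -- η w r says whether r occurs an odd number of times in the sequence of
  -- reflections t₁, …, tₖ crossed by w = s_{i₁} ⋯ s_{iₖ}, where
  -- tⱼ = s_{i₁} ⋯ s_{i_{j-1}} s_{iⱼ} s_{i_{j-1}} ⋯ s_{i₁} (Humphreys' n(w; r) mod 2).
  η : List (Fin rank) → W → Bool
  η []      r = false
  η (i ∷ w) r = (r == s i) xor η w (conj i r)

  conj⋆ : List (Fin rank) → W → W
  conj⋆ []      r = r
  conj⋆ (i ∷ w) r = conj⋆ w (conj i r)

  ⟦⟧-conj⋆ : ∀ w r → ⟦ w ⟧ · conj⋆ w r ≡ r · ⟦ w ⟧
  ⟦⟧-conj⋆ []      r = trans (idˡ r) (sym (idʳ r))
  ⟦⟧-conj⋆ (i ∷ w) r = begin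
    (s i · ⟦ w ⟧) · conj⋆ w (conj i r) ≡⟨ assoc _ _ _ ⟩
    s i · (⟦ w ⟧ · conj⋆ w (conj i r)) ≡⟨ cong (s i ·_) (⟦⟧-conj⋆ w (conj i r)) ⟩
    s i · ((s i · (r · s i)) · ⟦ w ⟧)  ≡⟨ cong (s i ·_) (solve W-monoid) ⟩
    s i · (s i · ((r · s i) · ⟦ w ⟧))  ≡⟨ s-cancelˡ i _ ⟩
    (r · s i) · ⟦ w ⟧                  ≡⟨ assoc _ _ _ ⟩
    r · (s i · ⟦ w ⟧)                  ∎

  η-∷ʳ : ∀ w t r → η (w ∷ʳ t) r ≡ η w r xor (conj⋆ w r == s t)
  η-∷ʳ []      t r = Bool.xor-identityʳ _
  η-∷ʳ (i ∷ w) t r = trans (cong ((r == s i) xor_) (η-∷ʳ w t (conj i r))) (sym (Bool.xor-assoc (r == s i) _ _))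

  η-deletion : ∀ w r → η w r ≡ true → Σ (List (Fin rank)) λ b → suc (length b) ≡ length w × r · ⟦ w ⟧ ≡ ⟦ b ⟧
  η-deletion (i ∷ w) r η≡true with η w (conj i r) in eq
  ... | true  = let b , len , r⟦w⟧≡ = η-deletion w (conj i r) eq in
    i ∷ b , cong suc len , (begin
      r · (s i · ⟦ w ⟧)                 ≡⟨ sym (s-cancelˡ i _) ⟩
      s i · (s i · (r · (s i · ⟦ w ⟧))) ≡⟨ cong (s i ·_) (solve W-monoid) ⟩
      s i · ((s i · (r · s i)) · ⟦ w ⟧) ≡⟨ cong (s i ·_) r⟦w⟧≡ ⟩
      s i · ⟦ b ⟧                       ∎)
  ... | false = w , refl , (begin
      r · (s i · ⟦ w ⟧)   ≡⟨ cong (_· (s i · ⟦ w ⟧)) (==⇒≡ (trans (sym (Bool.xor-identityʳ _)) η≡true)) ⟩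
      s i · (s i · ⟦ w ⟧) ≡⟨ s-cancelˡ i ⟦ w ⟧ ⟩
      ⟦ w ⟧               ∎)

  η-red⇒ℓ-< : ∀ r x → η (red x) r ≡ true → ℓ (r · x) < ℓ x
  η-red⇒ℓ-< r x η≡true = ℕ.≤-trans (s≤s (ℓ-min (r · x) b ⟦b⟧≡r·x)) (ℕ.≤-reflexive (trans len (red-len x)))
    where
    deletion = η-deletion (red x) r η≡true
    b = proj₁ deletion
    len = proj₁ (proj₂ deletion)
    ⟦b⟧≡r·x : ⟦ b ⟧ ≡ r · x
    ⟦b⟧≡r·x = sym (trans (cong (r ·_) (sym (red-eval x))) (proj₂ (proj₂ deletion)))

  flip : Fin rank → W × Bool → W × Bool
  flip i (r , b) = conj i r , b xor (r == s i)

  flip-involutive : ∀ i x → flip i (flip i x) ≡ x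
  flip-involutive i (r , b) = cong₂ _,_ (conj-involutive i r) (begin
    (b xor (r == s i)) xor (conj i r == s i) ≡⟨ cong ((b xor (r == s i)) xor_) (trans (==-conj i r (s i)) (cong (r ==_) (conj-s i))) ⟩
    (b xor (r == s i)) xor (r == s i)        ≡⟨ Bool.xor-assoc b _ _ ⟩
    b xor ((r == s i) xor (r == s i))        ≡⟨ cong (b xor_) (Bool.xor-same (r == s i)) ⟩
    b xor false                              ≡⟨ Bool.xor-identityʳ b ⟩
    b                                        ∎)

  flipPerm : Fin rank → Perm (W × Bool)
  flipPerm i = record { to = flip i ; from = flip i ; to-from = flip-involutive i ; from-to = flip-involutive i }

  flips : List (Fin rank) → W × Bool → W × Bool
  flips []      x = x
  flips (i ∷ w) x = flips w (flip i x)

  flips-η : ∀ w r b → flips w (r , b) ≡ (conj⋆ w r , b xor η w r)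
  flips-η []      r b = cong (r ,_) (sym (Bool.xor-identityʳ b))
  flips-η (i ∷ w) r b = trans (flips-η w (conj i r) (b xor (r == s i))) (cong (conj⋆ w (conj i r) ,_) (Bool.xor-assoc b _ _))

  reflections : List (Fin rank) → List W
  reflections []      = []
  reflections (i ∷ w) = s i ∷ map (conj i) (reflections w)

  occursOddly : W → List W → Bool
  occursOddly r []       = false
  occursOddly r (t ∷ ts) = (r == t) xor occursOddly r ts

  occursOddly-map-conj : ∀ i r ts → occursOddly (conj i r) ts ≡ occursOddly r (map (conj i) ts)
  occursOddly-map-conj i r []       = refl
  occursOddly-map-conj i r (t ∷ ts) = cong₂ _xor_ (==-conj i r t) (occursOddly-map-conj i r ts)

  occursOddly-++ : ∀ r ts us → occursOddly r (ts ++ us) ≡ occursOddly r ts xor occursOddly r us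
  occursOddly-++ r []       us = refl
  occursOddly-++ r (t ∷ ts) us = trans (cong ((r == t) xor_) (occursOddly-++ r ts us)) (sym (Bool.xor-assoc (r == t) _ _))

  η≡occursOddly : ∀ w r → η w r ≡ occursOddly r (reflections w)
  η≡occursOddly []      r = refl
  η≡occursOddly (i ∷ w) r = cong ((r == s i) xor_) (trans (η≡occursOddly w (conj i r)) (occursOddly-map-conj i r (reflections w)))

  module BraidRelation (i j : Fin rank) where

    g : W
    g = s i · s j

    g^ : ℕ → W
    g^ = mpow e _·_ g

    g^-+ : ∀ a b → g^ (a ℕ.+ b) ≡ g^ a · g^ b
    g^-+ zero    b = sym (idˡ _)
    g^-+ (suc a) b = trans (cong (g ·_) (g^-+ a b)) (sym (assoc _ _ _))

    g^-comm : ∀ c → g^ c · g ≡ g · g^ c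
    g^-comm zero    = trans (idˡ g) (sym (idʳ g))
    g^-comm (suc c) = trans (assoc _ _ _) (cong (g ·_) (g^-comm c))

    alternating : ℕ → List (Fin rank)
    alternating zero    = []
    alternating (suc k) = i ∷ j ∷ alternating k

    ⟦alternating⟧ : ∀ k → ⟦ alternating k ⟧ ≡ g^ k
    ⟦alternating⟧ zero    = refl
    ⟦alternating⟧ (suc k) = trans (cong (λ z → s i · (s j · z)) (⟦alternating⟧ k)) (sym (assoc _ _ _))

    -- The reflections crossed by (s i s j)^k are t 0, t 1, …, t (2k - 1).
    t : ℕ → W
    t c = g^ c · s i

    t-step : ∀ c → conj i (conj j (t c)) ≡ t (suc (suc c))
    t-step c = begin
      s i · ((s j · ((g^ c · s i) · s j)) · s i) ≡⟨ solve W-monoid ⟩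
      g · ((g^ c · g) · s i)                     ≡⟨ cong (λ z → g · (z · s i)) (g^-comm c) ⟩
      g · ((g · g^ c) · s i)                     ≡⟨ sym (assoc _ _ _) ⟩
      (g · (g · g^ c)) · s i                     ∎

    ts : ℕ → ℕ → List W
    ts c zero    = []
    ts c (suc n) = t c ∷ ts (suc c) n

    ts-step : ∀ n c → map (conj i) (map (conj j) (ts c n)) ≡ ts (suc (suc c)) n
    ts-step zero    c = refl
    ts-step (suc n) c = cong₂ _∷_ (t-step c) (ts-step n (suc c))

    ts-++ : ∀ a b c → ts c (a ℕ.+ b) ≡ ts c a ++ ts (c ℕ.+ a) b
    ts-++ zero    b c = cong (λ z → ts z b) (sym (ℕ.+-identityʳ c))
    ts-++ (suc a) b c = cong (t c ∷_) (trans (ts-++ a b (suc c)) (cong (λ z → ts (suc c) a ++ ts z b) (sym (ℕ.+-suc c a))))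

    reflections-alternating : ∀ k → reflections (alternating k) ≡ ts 0 (k ℕ.+ k)
    reflections-alternating zero    = refl
    reflections-alternating (suc k) = begin
      s i ∷ conj i (s j) ∷ map (conj i) (map (conj j) (reflections (alternating k)))
        ≡⟨ cong (λ z → s i ∷ conj i (s j) ∷ map (conj i) (map (conj j) z)) (reflections-alternating k) ⟩
      s i ∷ conj i (s j) ∷ map (conj i) (map (conj j) (ts 0 (k ℕ.+ k)))
        ≡⟨ cong₂ _∷_ (sym (idˡ (s i))) (cong₂ _∷_ (solve W-monoid) (ts-step (k ℕ.+ k) 0)) ⟩
      ts 0 (suc (suc (k ℕ.+ k)))
        ≡⟨ cong (λ z → ts 0 (suc z)) (sym (ℕ.+-suc k k)) ⟩
      ts 0 (suc k ℕ.+ suc k) ∎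

    g^m≡e : g^ (m i j) ≡ e
    g^m≡e = relations i j

    ts-periodic : ∀ n c → ts (m i j ℕ.+ c) n ≡ ts c n
    ts-periodic zero    c = refl
    ts-periodic (suc n) c = cong₂ _∷_ t-periodic (trans (cong (λ z → ts z n) (sym (ℕ.+-suc (m i j) c))) (ts-periodic n (suc c)))
      where
      t-periodic : t (m i j ℕ.+ c) ≡ t c
      t-periodic = cong (_· s i) (trans (g^-+ (m i j) c) (trans (cong (_· g^ c) g^m≡e) (idˡ _)))

    η-alternating : ∀ r → η (alternating (m i j)) r ≡ false
    η-alternating r = begin
      η (alternating M) r                               ≡⟨ η≡occursOddly (alternating M) r ⟩
      occursOddly r (reflections (alternating M))       ≡⟨ cong (occursOddly r) (trans (reflections-alternating M) (ts-++ M M 0)) ⟩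
      occursOddly r (ts 0 M ++ ts M M)                  ≡⟨ occursOddly-++ r (ts 0 M) (ts M M) ⟩
      occursOddly r (ts 0 M) xor occursOddly r (ts M M) ≡⟨ cong (λ z → occursOddly r (ts 0 M) xor occursOddly r z)
                                                                 (trans (cong (λ z → ts z M) (sym (ℕ.+-identityʳ M))) (ts-periodic M 0)) ⟩
      occursOddly r (ts 0 M) xor occursOddly r (ts 0 M) ≡⟨ Bool.xor-same (occursOddly r (ts 0 M)) ⟩
      false                                             ∎
      where M = m i j

    conj⋆-alternating : ∀ r → conj⋆ (alternating (m i j)) r ≡ r
    conj⋆-alternating r = begin
      conj⋆ w r         ≡⟨ sym (idˡ _) ⟩
      e · conj⋆ w r     ≡⟨ cong (_· conj⋆ w r) (sym ⟦w⟧≡e) ⟩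
      ⟦ w ⟧ · conj⋆ w r ≡⟨ ⟦⟧-conj⋆ w r ⟩
      r · ⟦ w ⟧         ≡⟨ cong (r ·_) ⟦w⟧≡e ⟩
      r · e             ≡⟨ idʳ r ⟩
      r                 ∎
      where
      w = alternating (m i j)
      ⟦w⟧≡e : ⟦ w ⟧ ≡ e
      ⟦w⟧≡e = trans (⟦alternating⟧ (m i j)) g^m≡e

    open Group (permGroup (W × Bool)) using (_≈_; _∙_; ε)

    gpow-flips : ∀ k x → to (gpow (permGroup (W × Bool)) (flipPerm i ∙ flipPerm j) k) x ≡ flips (alternating k) x
    gpow-flips zero    x = refl
    gpow-flips (suc k) x = gpow-flips k (flip j (flip i x))

    braid-relation : gpow (permGroup (W × Bool)) (flipPerm i ∙ flipPerm j) (m i j) ≈ ε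
    braid-relation (r , b) = begin
      to (gpow (permGroup (W × Bool)) (flipPerm i ∙ flipPerm j) (m i j)) (r , b) ≡⟨ gpow-flips (m i j) (r , b) ⟩
      flips (alternating (m i j)) (r , b)                                        ≡⟨ flips-η (alternating (m i j)) r b ⟩
      conj⋆ (alternating (m i j)) r , b xor η (alternating (m i j)) r            ≡⟨ cong₂ _,_ (conj⋆-alternating r) (cong (b xor_) (η-alternating r)) ⟩
      r , b xor false                                                            ≡⟨ cong (r ,_) (Bool.xor-identityʳ b) ⟩
      r , b                                                                      ∎

  titsHom : Σ (W → Perm (W × Bool)) λ φ →
    (∀ x y → Group._≈_ (permGroup (W × Bool)) (φ (x · y)) (Group._∙_ (permGroup (W × Bool)) (φ x) (φ y))) ×
    (∀ i → Group._≈_ (permGroup (W × Bool)) (φ (s i)) (flipPerm i))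
  titsHom = universal (permGroup (W × Bool)) flipPerm BraidRelation.braid-relation

  tits : W → Perm (W × Bool)
  tits = proj₁ titsHom

  tits-e : ∀ x → to (tits e) x ≡ x
  tits-e x = begin
    to (tits e) x                               ≡⟨ sym (from-to (tits e) _) ⟩
    from (tits e) (to (tits e) (to (tits e) x)) ≡⟨ cong (from (tits e)) (sym tits-e·e) ⟩
    from (tits e) (to (tits e) x)               ≡⟨ from-to (tits e) x ⟩
    x                                           ∎
    where
    tits-e·e : to (tits e) x ≡ to (tits e) (to (tits e) x)
    tits-e·e = trans (cong (λ z → to (tits z) x) (sym (idˡ e))) (proj₁ (proj₂ titsHom) e e x)

  tits-⟦⟧ : ∀ w x → to (tits ⟦ w ⟧) x ≡ flips w x
  tits-⟦⟧ []      x = tits-e x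
  tits-⟦⟧ (i ∷ w) x = begin
    to (tits (s i · ⟦ w ⟧)) x           ≡⟨ proj₁ (proj₂ titsHom) (s i) ⟦ w ⟧ x ⟩
    to (tits ⟦ w ⟧) (to (tits (s i)) x) ≡⟨ cong (to (tits ⟦ w ⟧)) (proj₂ (proj₂ titsHom) i x) ⟩
    to (tits ⟦ w ⟧) (flip i x)          ≡⟨ tits-⟦⟧ w (flip i x) ⟩
    flips (i ∷ w) x                     ∎

  η-invariant : ∀ w w' r → ⟦ w ⟧ ≡ ⟦ w' ⟧ → η w r ≡ η w' r
  η-invariant w w' r ⟦w⟧≡⟦w'⟧ = cong proj₂ (begin
    conj⋆ w r , false xor η w r   ≡⟨ sym (flips-η w r false) ⟩
    flips w (r , false)           ≡⟨ sym (tits-⟦⟧ w (r , false)) ⟩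
    to (tits ⟦ w ⟧) (r , false)   ≡⟨ cong (λ z → to (tits z) (r , false)) ⟦w⟧≡⟦w'⟧ ⟩
    to (tits ⟦ w' ⟧) (r , false)  ≡⟨ tits-⟦⟧ w' (r , false) ⟩
    flips w' (r , false)          ≡⟨ flips-η w' r false ⟩
    conj⋆ w' r , false xor η w' r ∎)

  η-red-of-descent : ∀ i x → ℓ (s i · x) < ℓ x → η (red x) (s i) ≡ true
  η-red-of-descent i x ℓsx<ℓx with η (red x) (s i) in eq
  ... | true  = refl
  ... | false = ⊥-elim (ℕ.<-asym ℓsx<ℓx ℓx<ℓsx)
    where
    ⟦red-sx⟧≡ : ⟦ red (s i · x) ⟧ ≡ ⟦ i ∷ red x ⟧
    ⟦red-sx⟧≡ = trans (red-eval (s i · x)) (cong (s i ·_) (sym (red-eval x)))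
    η-red-sx : η (red (s i · x)) (s i) ≡ true
    η-red-sx = begin
      η (red (s i · x)) (s i)                   ≡⟨ η-invariant (red (s i · x)) (i ∷ red x) (s i) ⟦red-sx⟧≡ ⟩
      (s i == s i) xor η (red x) (conj i (s i)) ≡⟨ cong₂ _xor_ (==-refl (s i)) (trans (cong (η (red x)) (conj-s i)) eq) ⟩
      true                                      ∎
    ℓx<ℓsx : ℓ x < ℓ (s i · x)
    ℓx<ℓsx = subst (λ z → ℓ z < ℓ (s i · x)) (s-cancelˡ i x) (η-red⇒ℓ-< (s i) (s i · x) η-red-sx)

  -- η identifies the reflection w⁻¹ · s i · w with s t.
  s·≡·s-of-ℓ : ∀ i t w → ℓ (s i · w) ≡ suc (ℓ w) → ℓ (w · s t) ≡ suc (ℓ w) → ℓ (s i · (w · s t)) ≡ ℓ w →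
    s i · w ≡ w · s t
  s·≡·s-of-ℓ i t w ℓsw≡ ℓwt≡ ℓswt≡ = begin
    s i · w                         ≡⟨ cong (s i ·_) (sym (red-eval w)) ⟩
    s i · ⟦ red w ⟧                 ≡⟨ sym (⟦⟧-conj⋆ (red w) (s i)) ⟩
    ⟦ red w ⟧ · conj⋆ (red w) (s i) ≡⟨ cong₂ _·_ (red-eval w) (==⇒≡ conj⋆≡st) ⟩
    w · s t                         ∎
    where
    η-red-wt : η (red w ∷ʳ t) (s i) ≡ true
    η-red-wt = trans (η-invariant (red w ∷ʳ t) (red (w · s t)) (s i)
                       (trans (⟦⟧-∷ʳ (red w) t) (trans (cong (_· s t) (red-eval w)) (sym (red-eval (w · s t))))))
                     (η-red-of-descent i (w · s t) (subst (ℓ (s i · (w · s t)) <_) (sym ℓwt≡) (ℕ.≤-reflexive (cong suc ℓswt≡))))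
    η-red-w : η (red w) (s i) ≡ false
    η-red-w with η (red w) (s i) in eq
    ... | false = refl
    ... | true  = ⊥-elim (ℕ.<-asym (η-red⇒ℓ-< (s i) w eq) (subst (ℓ w <_) (sym ℓsw≡) (ℕ.n<1+n _)))
    conj⋆≡st : (conj⋆ (red w) (s i) == s t) ≡ true
    conj⋆≡st = trans (sym (cong (_xor (conj⋆ (red w) (s i) == s t)) η-red-w)) (trans (sym (η-∷ʳ (red w) t (s i))) η-red-wt)

module HeckeAlgebra (CS : CoxeterSystem) (F : Finite CS) where

  open CoxeterSystem CS hiding (_⁻¹)
  open Finite F
  open Hecke CS F
  open CoxeterGroup CS
  open LaurentRing
  open import Level using (0ℓ)
  open import Algebra.Bundles using (CommutativeRing)
  open import Data.Bool using (Bool; true; false; if_then_else_)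
  open import Data.Empty using (⊥-elim)
  open import Data.Integer using (+_; -[1+_])
  open import Data.List using ([]; _∷_; _∷ʳ_; [_]; length)
  import Data.List.Properties as List
  open import Data.List.Membership.Propositional using (_∈_)
  open import Data.List.Relation.Unary.Any using (here; there)
  open import Data.List.Relation.Unary.All as All using (All; []; _∷_)
  open import Data.List.Relation.Unary.AllPairs using (_∷_)
  open import Data.List.Relation.Unary.Unique.Propositional using (Unique)
  open import Data.Nat as ℕ using (ℕ; suc; _<_; _≤_; _<?_)
  import Data.Nat.Properties as ℕ
  open import Data.Sum using (_⊎_; inj₁; inj₂)
  open import Relation.Binary.Bundles using (Setoid)
  open import Relation.Binary.PropositionalEquality hiding ([_]; setoid)
  open import Relation.Nullary using (Dec; yes; no; does)
  open import Relation.Nullary.Decidable using (dec-true; dec-false)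
  open import Tactic.RingSolver using (solve-∀)

  module L = CommutativeRing commutativeRing

  infix 4 _≃_
  record _≃_ (h h' : H) : Set where
    constructor pointwise
    field at : ∀ w → h w ≋ h' w
  open _≃_ public

  ≃-refl : ∀ {h} → h ≃ h
  ≃-refl = pointwise λ _ → L.refl

  ≃-sym : ∀ {h h'} → h ≃ h' → h' ≃ h
  ≃-sym (pointwise p) = pointwise λ w → L.sym (p w)

  ≃-trans : ∀ {h h' h''} → h ≃ h' → h' ≃ h'' → h ≃ h''
  ≃-trans (pointwise p) (pointwise p') = pointwise λ w → L.trans (p w) (p' w)

  ≃-reflexive : ∀ {h h'} → h ≡ h' → h ≃ h'
  ≃-reflexive refl = ≃-refl

  setoid : Setoid 0ℓ 0ℓ
  setoid = record { Carrier = H ; _≈_ = _≃_ ; isEquivalence = record { refl = ≃-refl ; sym = ≃-sym ; trans = ≃-trans } }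

  ≃⇒≈H : ∀ {h h'} → h ≃ h' → h ≈H h'
  ≃⇒≈H (pointwise p) w = ≋⇒≈L (p w)

  ≈H⇒≃ : ∀ {h h'} → h ≈H h' → h ≃ h'
  ≈H⇒≃ p = pointwise λ w → coeffwise (p w)

  +H-cong : ∀ {a a' b b'} → a ≃ a' → b ≃ b' → a +H b ≃ a' +H b'
  +H-cong (pointwise p) (pointwise q) = pointwise λ w → L.+-cong (p w) (q w)

  ⊙-cong : ∀ {c c' a a'} → c ≋ c' → a ≃ a' → c ⊙ a ≃ c' ⊙ a'
  ⊙-cong c≋c' (pointwise p) = pointwise λ w → L.*-cong c≋c' (p w)

  ⊙-congˡ : ∀ c {a a'} → a ≃ a' → c ⊙ a ≃ c ⊙ a'
  ⊙-congˡ c = ⊙-cong (L.refl {c})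

  record IsLinear (f : H → H) : Set where
    field
      cong-≃ : ∀ {h h'} → h ≃ h' → f h ≃ f h'
      +-hom  : ∀ h h' → f (h +H h') ≃ f h +H f h'
      ⊙-hom  : ∀ c h → f (c ⊙ h) ≃ c ⊙ f h
  open IsLinear public

  IsLinear-id : IsLinear (λ h → h)
  IsLinear-id = record { cong-≃ = λ p → p ; +-hom = λ _ _ → ≃-refl ; ⊙-hom = λ _ _ → ≃-refl }

  IsLinear-∘ : ∀ {f g} → IsLinear f → IsLinear g → IsLinear (λ h → g (f h))
  IsLinear-∘ {f} {g} lin-f lin-g = record
    { cong-≃ = λ p → cong-≃ lin-g (cong-≃ lin-f p)
    ; +-hom  = λ h h' → ≃-trans (cong-≃ lin-g (+-hom lin-f h h')) (+-hom lin-g (f h) (f h'))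
    ; ⊙-hom  = λ c h → ≃-trans (cong-≃ lin-g (⊙-hom lin-f c h)) (⊙-hom lin-g c (f h)) }

  linear-combination : ∀ {f} → IsLinear f → ∀ c d h h' → f (c ⊙ h +H d ⊙ h') ≃ c ⊙ f h +H d ⊙ f h'
  linear-combination lin c d h h' = ≃-trans (+-hom lin (c ⊙ h) (d ⊙ h')) (+H-cong (⊙-hom lin c h) (⊙-hom lin d h'))

  linear-0H : ∀ {f} → IsLinear f → f 0H ≃ 0H
  linear-0H {f} lin = ≃-trans (cong-≃ lin 0H≃0L⊙0H) (≃-trans (⊙-hom lin 0L 0H) (pointwise λ w → L.zeroˡ (f 0H w)))
    where
    0H≃0L⊙0H : 0H ≃ 0L ⊙ 0H
    0H≃0L⊙0H = pointwise λ w → L.sym (L.zeroˡ 0L)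

  ∑ : List W → (W → H) → H
  ∑ []       f = 0H
  ∑ (x ∷ xs) f = f x +H ∑ xs f

  ∑-cong : ∀ xs {f g} → (∀ x → f x ≃ g x) → ∑ xs f ≃ ∑ xs g
  ∑-cong []       p = ≃-refl
  ∑-cong (x ∷ xs) p = +H-cong (p x) (∑-cong xs p)

  ∑-linear : ∀ {f} → IsLinear f → ∀ xs g → f (∑ xs g) ≃ ∑ xs (λ x → f (g x))
  ∑-linear lin []       g = linear-0H lin
  ∑-linear lin (x ∷ xs) g = ≃-trans (+-hom lin (g x) (∑ xs g)) (+H-cong ≃-refl (∑-linear lin xs g))

  ∑-+ : ∀ xs f g → ∑ xs (λ x → f x +H g x) ≃ ∑ xs f +H ∑ xs g
  ∑-+ []       f g = pointwise λ w → L.sym (L.+-identityˡ 0L)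
  ∑-+ (x ∷ xs) f g = pointwise λ w →
    L.trans (L.+-cong L.refl (at (∑-+ xs f g) w)) (interchange (f x w) (g x w) (∑ xs f w) (∑ xs g w))
    where
    interchange : ∀ a b c d → (a +L b) +L (c +L d) ≋ (a +L c) +L (b +L d)
    interchange = solve-∀ almostCommutativeRing

  ∑-⊙ : ∀ xs c f → ∑ xs (λ x → c ⊙ f x) ≃ c ⊙ ∑ xs f
  ∑-⊙ []       c f = pointwise λ w → L.sym (L.zeroʳ c)
  ∑-⊙ (x ∷ xs) c f = pointwise λ w → L.trans (L.+-cong L.refl (at (∑-⊙ xs c f) w)) (L.sym (L.distribˡ c (f x w) (∑ xs f w)))

  δ-≡ : ∀ {x y} → x ≡ y → δ x y ≡ 1L
  δ-≡ {x} {y} x≡y with x ≟ y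
  ... | yes _  = refl
  ... | no x≢y = ⊥-elim (x≢y x≡y)

  δ-≢ : ∀ {x y} → x ≢ y → δ x y ≡ 0L
  δ-≢ {x} {y} x≢y with x ≟ y
  ... | yes x≡y = ⊥-elim (x≢y x≡y)
  ... | no _    = refl

  δ-sym : ∀ x y → δ x y ≡ δ y x
  δ-sym x y with x ≟ y
  ... | yes x≡y = sym (δ-≡ (sym x≡y))
  ... | no x≢y  = sym (δ-≢ (λ y≡x → x≢y (sym y≡x)))

  ∑-δ-∉ : ∀ xs y (f : W → H) → All (_≢ y) xs → ∑ xs (λ x → δ x y ⊙ f x) ≃ 0H
  ∑-δ-∉ []       y f []          = ≃-refl
  ∑-δ-∉ (x ∷ xs) y f (x≢y ∷ ∉xs) = pointwise λ w →
    L.trans (L.+-cong (L.trans (L.*-cong (L.reflexive (δ-≢ x≢y)) L.refl) (L.zeroˡ (f x w))) (at (∑-δ-∉ xs y f ∉xs) w)) (L.+-identityˡ 0L)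

  ∑-δ-∈ : ∀ xs → Unique xs → ∀ y → y ∈ xs → (f : W → H) → ∑ xs (λ x → δ x y ⊙ f x) ≃ f y
  ∑-δ-∈ (x ∷ xs) (x∉xs ∷ _) y (here refl) f = pointwise λ w →
    L.trans (L.+-cong (L.trans (L.*-cong (L.reflexive (δ-≡ refl)) L.refl) (L.*-identityˡ (f y w)))
                      (at (∑-δ-∉ xs y f (All.map (λ y≢x x≡y → y≢x (sym x≡y)) x∉xs)) w))
            (L.+-identityʳ (f y w))
  ∑-δ-∈ (x ∷ xs) (x∉xs ∷ unique-xs) y (there y∈xs) f = pointwise λ w →
    L.trans (L.+-cong (L.trans (L.*-cong (L.reflexive (δ-≢ (λ x≡y → All.lookup x∉xs y∈xs x≡y))) L.refl) (L.zeroˡ (f x w)))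
                      (at (∑-δ-∈ xs unique-xs y y∈xs f) w))
            (L.+-identityˡ (f y w))

  ∑-δ : ∀ y (f : W → H) → ∑ elems (λ x → δ x y ⊙ f x) ≃ f y
  ∑-δ y = ∑-δ-∈ elems unique y (complete y)

  ∑-cong-at : ∀ xs v {f g : W → H} → (∀ x → f x v ≋ g x v) → ∑ xs f v ≋ ∑ xs g v
  ∑-cong-at []       v p = L.refl
  ∑-cong-at (x ∷ xs) v p = L.+-cong (p x) (∑-cong-at xs v p)

  basis-expansion : ∀ h → h ≃ ∑ elems (λ z → h z ⊙ T z)
  basis-expansion h = pointwise λ v → L.sym (L.trans
    (∑-cong-at elems v (λ z → L.trans (L.*-comm (h z) (δ v z)) (L.reflexive (cong (_*L h z) (δ-sym v z)))))
    (at (∑-δ v (λ z _ → h z)) v))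

  linear-ext : ∀ {f g} → IsLinear f → IsLinear g → (∀ z → f (T z) ≃ g (T z)) → ∀ h → f h ≃ g h
  linear-ext {f} {g} lin-f lin-g f≃g h = begin
    f h                           ≈⟨ cong-≃ lin-f (basis-expansion h) ⟩
    f (∑ elems (λ z → h z ⊙ T z)) ≈⟨ ∑-linear lin-f elems _ ⟩
    ∑ elems (λ z → f (h z ⊙ T z)) ≈⟨ ∑-cong elems on-basis ⟩
    ∑ elems (λ z → g (h z ⊙ T z)) ≈⟨ ≃-sym (∑-linear lin-g elems _) ⟩
    g (∑ elems (λ z → h z ⊙ T z)) ≈⟨ ≃-sym (cong-≃ lin-g (basis-expansion h)) ⟩
    g h                           ∎
    where
    open SetoidReasoning setoid
    on-basis : ∀ z → f (h z ⊙ T z) ≃ g (h z ⊙ T z)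
    on-basis z = ≃-trans (⊙-hom lin-f (h z) (T z)) (≃-trans (⊙-congˡ (h z) (f≃g z)) (≃-sym (⊙-hom lin-g (h z) (T z))))

  -- rmulS i h v unfolds to step [ℓ v < ℓ (v · s i)] (h (v · s i)) (h v).
  step : Bool → Laurent → Laurent → Laurent
  step b x y = if b then qL *L x else x +L (qL -L 1L) *L y

  lmulS : Fin rank → H → H
  lmulS i h v = step (does (ℓ v <? ℓ (s i · v))) (h (s i · v)) (h v)

  lmulWord : List (Fin rank) → H → H
  lmulWord []       h = h
  lmulWord (i ∷ is) h = lmulS i (lmulWord is h)

  IsLinear-step : ∀ (b : W → Bool) (σ : W → W) → IsLinear (λ h v → step (b v) (h (σ v)) (h v))
  IsLinear-step b σ = record
    { cong-≃ = λ (pointwise p) → pointwise λ v → step-cong (b v) (p (σ v)) (p v)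
    ; +-hom  = λ h h' → pointwise λ v → step-+ (b v) (h (σ v)) (h' (σ v)) (h v) (h' v)
    ; ⊙-hom  = λ c h → pointwise λ v → step-* (b v) c (h (σ v)) (h v) }
    where
    step-cong : ∀ b {x x' y y'} → x ≋ x' → y ≋ y' → step b x y ≋ step b x' y'
    step-cong true  x≋x' y≋y' = L.*-cong (L.refl {qL}) x≋x'
    step-cong false x≋x' y≋y' = L.+-cong x≋x' (L.*-cong (L.refl {qL -L 1L}) y≋y')
    step-+ : ∀ b x x' y y' → step b (x +L x') (y +L y') ≋ step b x y +L step b x' y'
    step-+ true  x x' y y' = L.distribˡ qL x x'
    step-+ false x x' y y' = regroup x x' y y' (qL -L 1L)
      where
      regroup : ∀ x x' y y' Q → (x +L x') +L Q *L (y +L y') ≋ (x +L Q *L y) +L (x' +L Q *L y')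
      regroup = solve-∀ almostCommutativeRing
    step-* : ∀ b c x y → step b (c *L x) (c *L y) ≋ c *L step b x y
    step-* true  c x y = swap qL c x
      where
      swap : ∀ q c x → q *L (c *L x) ≋ c *L (q *L x)
      swap = solve-∀ almostCommutativeRing
    step-* false c x y = factor c x y (qL -L 1L)
      where
      factor : ∀ c x y Q → c *L x +L Q *L (c *L y) ≋ c *L (x +L Q *L y)
      factor = solve-∀ almostCommutativeRing

  IsLinear-rmulS : ∀ i → IsLinear (rmulS i)
  IsLinear-rmulS i = IsLinear-step (λ v → does (ℓ v <? ℓ (v · s i))) (_· s i)

  IsLinear-lmulS : ∀ i → IsLinear (lmulS i)
  IsLinear-lmulS i = IsLinear-step (λ v → does (ℓ v <? ℓ (s i · v))) (s i ·_)

  IsLinear-rmulWord : ∀ w → IsLinear (rmulWord w)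
  IsLinear-rmulWord []      = IsLinear-id
  IsLinear-rmulWord (i ∷ w) = IsLinear-∘ (IsLinear-rmulS i) (IsLinear-rmulWord w)

  IsLinear-lmulWord : ∀ w → IsLinear (lmulWord w)
  IsLinear-lmulWord []      = IsLinear-id
  IsLinear-lmulWord (i ∷ w) = IsLinear-∘ (IsLinear-lmulWord w) (IsLinear-lmulS i)

  ∑-unique : ∀ {S : List W → H} (g : W → H) → S [] ≡ 0H → (∀ x xs → S (x ∷ xs) ≡ g x +H S xs) → ∀ xs → S xs ≡ ∑ xs g
  ∑-unique g S[] S∷ []       = S[]
  ∑-unique g S[] S∷ (x ∷ xs) = trans (S∷ x xs) (cong (g x +H_) (∑-unique g S[] S∷ xs))

  mutual
    -- The sum in the definition of _*H_ is private to Defs; abstracting over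
    -- elems exposes it, and the left-hand side of unfold-∑ is that sum.
    *H-∑ : ∀ h h' → h *H h' ≃ ∑ elems (λ x → h' x ⊙ rmulWord (red x) h)
    *H-∑ h h' with elems
    ... | xs = ≃-reflexive (unfold-∑ h h' xs)

    unfold-∑ : ∀ h h' xs → _ ≡ ∑ xs (λ x → h' x ⊙ rmulWord (red x) h)
    unfold-∑ h h' = ∑-unique (λ x → h' x ⊙ rmulWord (red x) h) refl (λ _ _ → refl)

  *H-T : ∀ h y → h *H T y ≃ rmulWord (red y) h
  *H-T h y = ≃-trans (*H-∑ h (T y)) (∑-δ y (λ x → rmulWord (red x) h))

  IsLinear-*Hʳ : ∀ a → IsLinear (a *H_)
  IsLinear-*Hʳ a = record
    { cong-≃ = λ {h} {h'} (pointwise p) → begin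
        a *H h                                    ≈⟨ *H-∑ a h ⟩
        ∑ elems (λ x → h x ⊙ rmulWord (red x) a)  ≈⟨ ∑-cong elems (λ x → ⊙-cong (p x) ≃-refl) ⟩
        ∑ elems (λ x → h' x ⊙ rmulWord (red x) a) ≈⟨ ≃-sym (*H-∑ a h') ⟩
        a *H h'                                   ∎
    ; +-hom = λ h h' → begin
        a *H (h +H h')                                            ≈⟨ *H-∑ a (h +H h') ⟩
        ∑ elems (λ x → (h x +L h' x) ⊙ aₓ x)                      ≈⟨ ∑-cong elems (λ x → pointwise λ w → L.distribʳ (aₓ x w) (h x) (h' x)) ⟩
        ∑ elems (λ x → h x ⊙ aₓ x +H h' x ⊙ aₓ x)                 ≈⟨ ∑-+ elems _ _ ⟩
        ∑ elems (λ x → h x ⊙ aₓ x) +H ∑ elems (λ x → h' x ⊙ aₓ x) ≈⟨ ≃-sym (+H-cong (*H-∑ a h) (*H-∑ a h')) ⟩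
        a *H h +H a *H h'                                         ∎
    ; ⊙-hom = λ c h → begin
        a *H (c ⊙ h)                      ≈⟨ *H-∑ a (c ⊙ h) ⟩
        ∑ elems (λ x → (c *L h x) ⊙ aₓ x) ≈⟨ ∑-cong elems (λ x → pointwise λ w → L.*-assoc c (h x) (aₓ x w)) ⟩
        ∑ elems (λ x → c ⊙ (h x ⊙ aₓ x))  ≈⟨ ∑-⊙ elems c _ ⟩
        c ⊙ ∑ elems (λ x → h x ⊙ aₓ x)    ≈⟨ ⊙-congˡ c (≃-sym (*H-∑ a h)) ⟩
        c ⊙ (a *H h)                      ∎ }
    where
    open SetoidReasoning setoid
    aₓ : W → H
    aₓ x = rmulWord (red x) a

  IsLinear-*Hˡ : ∀ b → IsLinear (_*H b)
  IsLinear-*Hˡ b = record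
    { cong-≃ = λ {a} {a'} a≃a' → begin
        a *H b                                    ≈⟨ *H-∑ a b ⟩
        ∑ elems (λ x → b x ⊙ rmulWord (red x) a)  ≈⟨ ∑-cong elems (λ x → ⊙-congˡ (b x) (cong-≃ (ρ x) a≃a')) ⟩
        ∑ elems (λ x → b x ⊙ rmulWord (red x) a') ≈⟨ ≃-sym (*H-∑ a' b) ⟩
        a' *H b                                   ∎
    ; +-hom = λ a a' → begin
        (a +H a') *H b                                                        ≈⟨ *H-∑ (a +H a') b ⟩
        ∑ elems (λ x → b x ⊙ rmulWord (red x) (a +H a'))                      ≈⟨ ∑-cong elems (λ x → ≃-trans (⊙-congˡ (b x) (+-hom (ρ x) a a'))
                                                                                                         (pointwise λ w → L.distribˡ (b x) _ _)) ⟩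
        ∑ elems (λ x → b x ⊙ rmulWord (red x) a +H b x ⊙ rmulWord (red x) a') ≈⟨ ∑-+ elems _ _ ⟩
        ∑ elems (λ x → b x ⊙ rmulWord (red x) a) +H ∑ elems (λ x → b x ⊙ rmulWord (red x) a')
                                                                              ≈⟨ ≃-sym (+H-cong (*H-∑ a b) (*H-∑ a' b)) ⟩
        a *H b +H a' *H b                                                     ∎
    ; ⊙-hom = λ c a → begin
        (c ⊙ a) *H b                                   ≈⟨ *H-∑ (c ⊙ a) b ⟩
        ∑ elems (λ x → b x ⊙ rmulWord (red x) (c ⊙ a)) ≈⟨ ∑-cong elems (λ x → ≃-trans (⊙-congˡ (b x) (⊙-hom (ρ x) c a))
                                                                                     (pointwise λ w → swap (b x) c _)) ⟩
        ∑ elems (λ x → c ⊙ (b x ⊙ rmulWord (red x) a)) ≈⟨ ∑-⊙ elems c _ ⟩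
        c ⊙ ∑ elems (λ x → b x ⊙ rmulWord (red x) a)   ≈⟨ ⊙-congˡ c (≃-sym (*H-∑ a b)) ⟩
        c ⊙ (a *H b)                                   ∎ }
    where
    open SetoidReasoning setoid
    ρ : ∀ x → IsLinear (rmulWord (red x))
    ρ x = IsLinear-rmulWord (red x)
    swap : ∀ b c x → b *L (c *L x) ≋ c *L (b *L x)
    swap = solve-∀ almostCommutativeRing

  -- rmulS i and lmulS i are both of this shape, with σ = (_· s i) and (s i ·_).
  module InvolutionAction (σ : W → W) (σ-involutive : ∀ v → σ (σ v) ≡ v) where

    act : H → H
    act h v = step (does (ℓ v <? ℓ (σ v))) (h (σ v)) (h v)

    private
      ℓ≢⇒σ≢ : ∀ {y} → ℓ (σ y) ≢ ℓ y → σ y ≢ y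
      ℓ≢⇒σ≢ ℓ≢ σy≡y = ℓ≢ (cong ℓ σy≡y)

      ≢σ⇒σ≢ : ∀ {v y} → v ≢ σ y → σ v ≢ y
      ≢σ⇒σ≢ {v} v≢σy σv≡y = v≢σy (trans (sym (σ-involutive v)) (cong σ σv≡y))

      step-cong-≡ : ∀ {b b' x x' y y'} → b ≡ b' → x ≡ x' → y ≡ y' → step b x y ≋ step b' x' y'
      step-cong-≡ refl refl refl = L.refl

      step-0 : ∀ b → step b 0L 0L ≋ 0L
      step-0 true  = L.zeroʳ qL
      step-0 false = L.trans (L.+-cong (L.refl {0L}) (L.zeroʳ (qL -L 1L))) (L.+-identityʳ 0L)

      <-up : ∀ {m n} → n ≡ suc m → does (m <? n) ≡ true
      <-up {m} {n} n≡ = dec-true (m <? n) (subst (m <_) (sym n≡) (ℕ.n<1+n m))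

      <-down : ∀ {m n} → m ≡ suc n → does (m <? n) ≡ false
      <-down {m} {n} m≡ = dec-false (m <? n) (λ m<n → ℕ.<-asym m<n (subst (n <_) (sym m≡) (ℕ.n<1+n n)))

    act-T-up : ∀ y → ℓ (σ y) ≡ suc (ℓ y) → act (T y) ≃ T (σ y)
    act-T-up y up = pointwise λ v → at-v v (v ≟ σ y) (v ≟ y)
      where
      σy≢y : σ y ≢ y
      σy≢y = ℓ≢⇒σ≢ (λ eq → ℕ.1+n≢n (trans (sym up) eq))
      at-v : ∀ v → Dec (v ≡ σ y) → Dec (v ≡ y) → act (T y) v ≋ T (σ y) v
      at-v v (yes refl) _ = begin
        step (does (ℓ (σ y) <? ℓ (σ (σ y)))) (δ (σ (σ y)) y) (δ (σ y) y)
          ≈⟨ step-cong-≡ (<-down (trans up (cong (λ z → suc (ℓ z)) (sym (σ-involutive y))))) (δ-≡ (σ-involutive y)) (δ-≢ σy≢y) ⟩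
        1L +L (qL -L 1L) *L 0L ≈⟨ L.trans (L.+-cong (L.refl {1L}) (L.zeroʳ (qL -L 1L))) (L.+-identityʳ 1L) ⟩
        1L                     ≈⟨ L.reflexive (sym (δ-≡ refl)) ⟩
        δ (σ y) (σ y)          ∎
        where open SetoidReasoning L.setoid
      at-v v (no v≢σy) (yes refl) = begin
        step (does (ℓ y <? ℓ (σ y))) (δ (σ y) y) (δ y y) ≈⟨ step-cong-≡ (<-up up) (δ-≢ σy≢y) (refl {x = δ y y}) ⟩
        qL *L 0L                                         ≈⟨ L.zeroʳ qL ⟩
        0L                                               ≈⟨ L.reflexive (sym (δ-≢ v≢σy)) ⟩
        δ y (σ y)                                        ∎
        where open SetoidReasoning L.setoid
      at-v v (no v≢σy) (no v≢y) = begin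
        step (does (ℓ v <? ℓ (σ v))) (δ (σ v) y) (δ v y) ≈⟨ step-cong-≡ refl (δ-≢ (≢σ⇒σ≢ v≢σy)) (δ-≢ v≢y) ⟩
        step (does (ℓ v <? ℓ (σ v))) 0L 0L               ≈⟨ step-0 _ ⟩
        0L                                               ≈⟨ L.reflexive (sym (δ-≢ v≢σy)) ⟩
        δ v (σ y)                                        ∎
        where open SetoidReasoning L.setoid

    act-T-down : ∀ y → ℓ y ≡ suc (ℓ (σ y)) → act (T y) ≃ qL ⊙ T (σ y) +H (qL -L 1L) ⊙ T y
    act-T-down y down = pointwise λ v → at-v v (v ≟ σ y) (v ≟ y)
      where
      σy≢y : σ y ≢ y
      σy≢y = ℓ≢⇒σ≢ (λ eq → ℕ.1+n≢n (trans (sym down) (sym eq)))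
      plus-zero : ∀ q Q a → q *L a ≋ q *L a +L Q *L 0L
      plus-zero q Q a = L.sym (L.trans (L.+-cong L.refl (L.zeroʳ Q)) (L.+-identityʳ (q *L a)))
      zero-plus : ∀ q Q a → 0L +L Q *L a ≋ q *L 0L +L Q *L a
      zero-plus q Q a = L.+-cong (L.sym (L.zeroʳ q)) L.refl
      zeros : ∀ q Q → 0L ≋ q *L 0L +L Q *L 0L
      zeros q Q = L.sym (L.trans (L.+-cong (L.zeroʳ q) (L.zeroʳ Q)) (L.+-identityʳ 0L))
      at-v : ∀ v → Dec (v ≡ σ y) → Dec (v ≡ y) → act (T y) v ≋ (qL ⊙ T (σ y) +H (qL -L 1L) ⊙ T y) v
      at-v v (yes refl) _ = begin
        step (does (ℓ (σ y) <? ℓ (σ (σ y)))) (δ (σ (σ y)) y) (δ (σ y) y)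
          ≈⟨ step-cong-≡ (<-up (trans (cong ℓ (σ-involutive y)) down)) (δ-≡ (σ-involutive y)) (refl {x = δ (σ y) y}) ⟩
        qL *L 1L                                       ≈⟨ plus-zero qL (qL -L 1L) 1L ⟩
        qL *L 1L +L (qL -L 1L) *L 0L                   ≈⟨ L.reflexive (sym (cong₂ (λ a b → qL *L a +L (qL -L 1L) *L b) (δ-≡ refl) (δ-≢ σy≢y))) ⟩
        qL *L δ (σ y) (σ y) +L (qL -L 1L) *L δ (σ y) y ∎
        where open SetoidReasoning L.setoid
      at-v v (no v≢σy) (yes refl) = begin
        step (does (ℓ y <? ℓ (σ y))) (δ (σ y) y) (δ y y) ≈⟨ step-cong-≡ (<-down down) (δ-≢ σy≢y) (refl {x = δ y y}) ⟩
        0L +L (qL -L 1L) *L δ y y                        ≈⟨ zero-plus qL (qL -L 1L) (δ y y) ⟩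
        qL *L 0L +L (qL -L 1L) *L δ y y                  ≈⟨ L.reflexive (sym (cong (λ a → qL *L a +L (qL -L 1L) *L δ y y) (δ-≢ v≢σy))) ⟩
        qL *L δ y (σ y) +L (qL -L 1L) *L δ y y           ∎
        where open SetoidReasoning L.setoid
      at-v v (no v≢σy) (no v≢y) = begin
        step (does (ℓ v <? ℓ (σ v))) (δ (σ v) y) (δ v y) ≈⟨ step-cong-≡ refl (δ-≢ (≢σ⇒σ≢ v≢σy)) (δ-≢ v≢y) ⟩
        step (does (ℓ v <? ℓ (σ v))) 0L 0L               ≈⟨ step-0 _ ⟩
        0L                                               ≈⟨ zeros qL (qL -L 1L) ⟩
        qL *L 0L +L (qL -L 1L) *L 0L                     ≈⟨ L.reflexive (sym (cong₂ (λ a b → qL *L a +L (qL -L 1L) *L b) (δ-≢ v≢σy) (δ-≢ v≢y))) ⟩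
        qL *L δ v (σ y) +L (qL -L 1L) *L δ v y           ∎
        where open SetoidReasoning L.setoid

  open InvolutionAction using (act-T-up; act-T-down)

  rmulS-T-up : ∀ i y → ℓ (y · s i) ≡ suc (ℓ y) → rmulS i (T y) ≃ T (y · s i)
  rmulS-T-up i = act-T-up (_· s i) (s-cancelʳ i)

  rmulS-T-down : ∀ i y → ℓ y ≡ suc (ℓ (y · s i)) → rmulS i (T y) ≃ qL ⊙ T (y · s i) +H (qL -L 1L) ⊙ T y
  rmulS-T-down i = act-T-down (_· s i) (s-cancelʳ i)

  lmulS-T-up : ∀ i y → ℓ (s i · y) ≡ suc (ℓ y) → lmulS i (T y) ≃ T (s i · y)
  lmulS-T-up i = act-T-up (s i ·_) (s-cancelˡ i)

  ℓ-·s-up : ∀ i y a → ℓ ((y · s i) · ⟦ a ⟧) ≡ ℓ y ℕ.+ suc (length a) → ℓ (y · s i) ≡ suc (ℓ y)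
  ℓ-·s-up i y a ℓ≡ with ℓ-·s-cases i y
  ... | inj₁ up   = up
  ... | inj₂ down = ⊥-elim (ℕ.<-irrefl ℓ≡ (begin-strict
    ℓ ((y · s i) · ⟦ a ⟧)          ≤⟨ ℓ-· (y · s i) ⟦ a ⟧ ⟩
    ℓ (y · s i) ℕ.+ ℓ ⟦ a ⟧        ≤⟨ ℕ.+-monoʳ-≤ (ℓ (y · s i)) (ℓ-⟦⟧ a) ⟩
    ℓ (y · s i) ℕ.+ length a       <⟨ ℕ.+-monoʳ-< (ℓ (y · s i)) (ℕ.n<1+n (length a)) ⟩
    ℓ (y · s i) ℕ.+ suc (length a) <⟨ ℕ.+-monoˡ-< (suc (length a)) (ℕ.≤-reflexive (sym down)) ⟩
    ℓ y ℕ.+ suc (length a)         ∎))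
    where open ℕ.≤-Reasoning

  rmulWord-T : ∀ a y → ℓ (y · ⟦ a ⟧) ≡ ℓ y ℕ.+ length a → rmulWord a (T y) ≃ T (y · ⟦ a ⟧)
  rmulWord-T []      y _ = ≃-reflexive (cong T (sym (idʳ y)))
  rmulWord-T (i ∷ a) y ℓ≡ = begin
    rmulWord a (rmulS i (T y)) ≈⟨ cong-≃ (IsLinear-rmulWord a) (rmulS-T-up i y up) ⟩
    rmulWord a (T (y · s i))   ≈⟨ rmulWord-T a (y · s i) ℓ-ys⟦a⟧≡ ⟩
    T ((y · s i) · ⟦ a ⟧)      ≈⟨ ≃-reflexive (cong T (assoc y (s i) ⟦ a ⟧)) ⟩
    T (y · (s i · ⟦ a ⟧))      ∎
    where
    open SetoidReasoning setoid
    ℓ-ys⟦a⟧ : ℓ ((y · s i) · ⟦ a ⟧) ≡ ℓ y ℕ.+ suc (length a)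
    ℓ-ys⟦a⟧ = trans (cong ℓ (assoc y (s i) ⟦ a ⟧)) ℓ≡
    up : ℓ (y · s i) ≡ suc (ℓ y)
    up = ℓ-·s-up i y a ℓ-ys⟦a⟧
    ℓ-ys⟦a⟧≡ : ℓ ((y · s i) · ⟦ a ⟧) ≡ ℓ (y · s i) ℕ.+ length a
    ℓ-ys⟦a⟧≡ = trans ℓ-ys⟦a⟧ (trans (ℕ.+-suc (ℓ y) (length a)) (cong (ℕ._+ length a) (sym up)))

  lmulWord-T : ∀ a y → ℓ (⟦ a ⟧ · y) ≡ length a ℕ.+ ℓ y → lmulWord a (T y) ≃ T (⟦ a ⟧ · y)
  lmulWord-T []      y _ = ≃-reflexive (cong T (sym (idˡ y)))
  lmulWord-T (i ∷ a) y ℓ≡ = begin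
    lmulS i (lmulWord a (T y)) ≈⟨ cong-≃ (IsLinear-lmulS i) (lmulWord-T a y ℓ-z≡) ⟩
    lmulS i (T z)              ≈⟨ lmulS-T-up i z up ⟩
    T (s i · z)                ≈⟨ ≃-reflexive (cong T (sym (assoc (s i) ⟦ a ⟧ y))) ⟩
    T ((s i · ⟦ a ⟧) · y)      ∎
    where
    open SetoidReasoning setoid
    z = ⟦ a ⟧ · y
    ℓ-sz : ℓ (s i · z) ≡ suc (length a ℕ.+ ℓ y)
    ℓ-sz = trans (cong ℓ (sym (assoc (s i) ⟦ a ⟧ y))) ℓ≡
    ℓ-z≡ : ℓ z ≡ length a ℕ.+ ℓ y
    ℓ-z≡ = ℕ.≤-antisym (ℕ.≤-trans (ℓ-· ⟦ a ⟧ y) (ℕ.+-monoˡ-≤ (ℓ y) (ℓ-⟦⟧ a)))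
                       (ℕ.≤-pred (ℕ.≤-trans (ℕ.≤-reflexive (sym ℓ-sz)) (ℓ-s· i z)))
    up : ℓ (s i · z) ≡ suc (ℓ z)
    up = trans ℓ-sz (cong suc (sym ℓ-z≡))

  rmulWord-red : ∀ x → rmulWord (red x) (T e) ≃ T x
  rmulWord-red x = ≃-trans (rmulWord-T (red x) e ℓ≡) (≃-reflexive (cong T e·x≡x))
    where
    e·x≡x : e · ⟦ red x ⟧ ≡ x
    e·x≡x = trans (idˡ _) (red-eval x)
    ℓ≡ : ℓ (e · ⟦ red x ⟧) ≡ ℓ e ℕ.+ length (red x)
    ℓ≡ = trans (cong ℓ e·x≡x) (trans (sym (red-len x)) (cong (ℕ._+ length (red x)) (sym ℓ-e)))

  lmulWord-red : ∀ x → lmulWord (red x) (T e) ≃ T x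
  lmulWord-red x = ≃-trans (lmulWord-T (red x) e ℓ≡) (≃-reflexive (cong T x·e≡x))
    where
    x·e≡x : ⟦ red x ⟧ · e ≡ x
    x·e≡x = trans (idʳ _) (red-eval x)
    ℓ≡ : ℓ (⟦ red x ⟧ · e) ≡ length (red x) ℕ.+ ℓ e
    ℓ≡ = trans (cong ℓ x·e≡x) (trans (sym (red-len x)) (trans (sym (ℕ.+-identityʳ _)) (cong (length (red x) ℕ.+_) (sym ℓ-e))))

  -- Left and right multiplications by generators commute

  -- With D₁ = [ℓ v < ℓ (s v)], D₂ = [ℓ (s v) < ℓ (s v t)], D₃ = [ℓ v < ℓ (v t)],
  -- D₄ = [ℓ (v t) < ℓ (s v t)], these are the six configurations allowed by the
  -- ±1 rule for lengths; when s v t is as long as v, then s v = v t, which is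
  -- recorded as x₂ ≋ x₃ for x₂ = h (s v), x₃ = h (v t).
  data Configuration : Bool → Bool → Bool → Bool → Laurent → Laurent → Set where
    ↑↑↑↑ : ∀ {x₂ x₃} → Configuration true true true true x₂ x₃
    ↑↓↑↓ : ∀ {x₂ x₃} → x₂ ≋ x₃ → Configuration true false true false x₂ x₃
    ↑↓↓↑ : ∀ {x₂ x₃} → Configuration true false false true x₂ x₃
    ↓↑↑↓ : ∀ {x₂ x₃} → Configuration false true true false x₂ x₃
    ↓↑↓↑ : ∀ {x₂ x₃} → x₂ ≋ x₃ → Configuration false true false true x₂ x₃
    ↓↓↓↓ : ∀ {x₂ x₃} → Configuration false false false false x₂ x₃

  private
    distrib-q : ∀ q Q x y → q *L (x +L Q *L y) ≋ q *L x +L Q *L (q *L y)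
    distrib-q = solve-∀ almostCommutativeRing

  step-commute : ∀ {D₁ D₂ D₃ D₄ x₂ x₃} x₁ x₄ → Configuration D₁ D₂ D₃ D₄ x₂ x₃ →
    step D₁ (step D₂ x₁ x₂) (step D₃ x₃ x₄) ≋ step D₃ (step D₄ x₁ x₃) (step D₁ x₂ x₄)
  step-commute x₁ x₄ ↑↑↑↑ = L.refl
  step-commute x₁ x₄ (↑↓↑↓ x₂≋x₃) = L.*-cong (L.refl {qL}) (L.+-cong (L.refl {x₁}) (L.*-cong (L.refl {qL -L 1L}) x₂≋x₃))
  step-commute {x₂ = x₂} x₁ x₄ ↑↓↓↑ = distrib-q qL (qL -L 1L) x₁ x₂
  step-commute {x₃ = x₃} x₁ x₄ ↓↑↑↓ = L.sym (distrib-q qL (qL -L 1L) x₁ x₃)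
  step-commute x₁ x₄ (↓↑↓↑ x₂≋x₃) =
    L.+-cong (L.refl {qL *L x₁}) (L.*-cong (L.refl {qL -L 1L}) (L.+-cong (L.sym x₂≋x₃) (L.refl {(qL -L 1L) *L x₄})))
  step-commute {x₂ = x₂} {x₃ = x₃} x₁ x₄ ↓↓↓↓ = exchange (qL -L 1L) x₁ x₂ x₃ x₄
    where
    exchange : ∀ Q x₁ x₂ x₃ x₄ → (x₁ +L Q *L x₂) +L Q *L (x₃ +L Q *L x₄) ≋ (x₁ +L Q *L x₃) +L Q *L (x₂ +L Q *L x₄)
    exchange = solve-∀ almostCommutativeRing

  <?-suc : ∀ n → does (n <? suc n) ≡ true
  <?-suc n = dec-true (n <? suc n) (ℕ.n<1+n n)

  suc-<? : ∀ n → does (suc n <? n) ≡ false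
  suc-<? n = dec-false (suc n <? n) (ℕ.<-asym (ℕ.n<1+n n))

  configuration : ∀ a b c d x₂ x₃ →
    b ≡ suc a ⊎ a ≡ suc b → c ≡ suc a ⊎ a ≡ suc c → d ≡ suc b ⊎ b ≡ suc d → d ≡ suc c ⊎ c ≡ suc d →
    (b ≡ suc a → c ≡ suc a → d ≡ a → x₂ ≋ x₃) → (a ≡ suc b → d ≡ suc b → c ≡ b → x₂ ≋ x₃) →
    Configuration (does (a <? b)) (does (b <? d)) (does (a <? c)) (does (c <? d)) x₂ x₃
  configuration a _ _ _ _ _ (inj₁ refl) (inj₁ refl) (inj₁ refl) (inj₁ refl) _ _
    rewrite <?-suc a = ↑↑↑↑
  configuration a _ _ _ _ _ (inj₁ refl) (inj₁ refl) (inj₁ refl) (inj₂ ())   _ _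
  configuration a _ _ _ _ _ (inj₁ refl) (inj₁ refl) (inj₂ refl) (inj₁ ())   _ _
  configuration a _ _ _ _ _ (inj₁ refl) (inj₁ refl) (inj₂ refl) (inj₂ refl) eq _
    rewrite <?-suc a | suc-<? a = ↑↓↑↓ (eq refl refl refl)
  configuration _ _ c _ _ _ (inj₁ refl) (inj₂ refl) (inj₁ refl) (inj₁ ())   _ _
  configuration _ _ c _ _ _ (inj₁ refl) (inj₂ refl) (inj₁ refl) (inj₂ ())   _ _
  configuration _ _ c _ _ _ (inj₁ refl) (inj₂ refl) (inj₂ refl) (inj₁ refl) _ _
    rewrite suc-<? c | <?-suc c = ↑↓↓↑
  configuration _ _ c _ _ _ (inj₁ refl) (inj₂ refl) (inj₂ refl) (inj₂ ())   _ _
  configuration _ b _ _ _ _ (inj₂ refl) (inj₁ refl) (inj₁ refl) (inj₁ ())   _ _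
  configuration _ b _ _ _ _ (inj₂ refl) (inj₁ refl) (inj₁ refl) (inj₂ refl) _ _
    rewrite suc-<? b | <?-suc b = ↓↑↑↓
  configuration _ b _ _ _ _ (inj₂ refl) (inj₁ refl) (inj₂ refl) (inj₁ ())   _ _
  configuration _ b _ _ _ _ (inj₂ refl) (inj₁ refl) (inj₂ refl) (inj₂ ())   _ _
  configuration _ b _ _ _ _ (inj₂ refl) (inj₂ refl) (inj₁ refl) (inj₁ refl) _ eq
    rewrite suc-<? b | <?-suc b = ↓↑↓↑ (eq refl refl refl)
  configuration _ b _ _ _ _ (inj₂ refl) (inj₂ refl) (inj₁ refl) (inj₂ ())   _ _
  configuration _ b _ _ _ _ (inj₂ refl) (inj₂ refl) (inj₂ refl) (inj₁ ())   _ _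
  configuration _ _ _ d _ _ (inj₂ refl) (inj₂ refl) (inj₂ refl) (inj₂ refl) _ _
    rewrite suc-<? d = ↓↓↓↓

  lmulS-rmulS : ∀ i j h → lmulS i (rmulS j h) ≃ rmulS j (lmulS i h)
  lmulS-rmulS i j h = pointwise λ v → L.trans (L.reflexive (reassociate v)) (step-commute (h (s i · (v · s j))) (h v) (config v))
    where
    sv vt svt : W → W
    sv  v = s i · v
    vt  v = v · s j
    svt v = s i · (v · s j)

    reassociate : ∀ v → lmulS i (rmulS j h) v ≡
      step (does (ℓ v <? ℓ (sv v))) (step (does (ℓ (sv v) <? ℓ (svt v))) (h (svt v)) (h (sv v))) (step (does (ℓ v <? ℓ (vt v))) (h (vt v)) (h v))
    reassociate v = cong (λ z → step (does (ℓ v <? ℓ (sv v))) (step (does (ℓ (sv v) <? ℓ z)) (h z) (h (sv v))) (step (does (ℓ v <? ℓ (vt v))) (h (vt v)) (h v)))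
                         (assoc (s i) v (s j))

    ℓ-svt-cases : ∀ v → ℓ (svt v) ≡ suc (ℓ (sv v)) ⊎ ℓ (sv v) ≡ suc (ℓ (svt v))
    ℓ-svt-cases v = subst (λ z → ℓ z ≡ suc (ℓ (sv v)) ⊎ ℓ (sv v) ≡ suc (ℓ z)) (assoc (s i) v (s j)) (ℓ-·s-cases j (sv v))

    sv≡vt-up : ∀ v → ℓ (sv v) ≡ suc (ℓ v) → ℓ (vt v) ≡ suc (ℓ v) → ℓ (svt v) ≡ ℓ v → h (sv v) ≋ h (vt v)
    sv≡vt-up v ℓsv ℓvt ℓsvt = L.reflexive (cong h (s·≡·s-of-ℓ i j v ℓsv ℓvt ℓsvt))

    sv≡vt-down : ∀ v → ℓ v ≡ suc (ℓ (sv v)) → ℓ (svt v) ≡ suc (ℓ (sv v)) → ℓ (vt v) ≡ ℓ (sv v) → h (sv v) ≋ h (vt v)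
    sv≡vt-down v ℓv ℓsvt ℓvt = L.reflexive (cong h (sym (trans (cong (_· s j) v≡w·t) (s-cancelʳ j w))))
      where
      w = s i · v
      v≡w·t : v ≡ w · s j
      v≡w·t = trans (sym (s-cancelˡ i v)) (s·≡·s-of-ℓ i j w
        (trans (cong ℓ (s-cancelˡ i v)) ℓv)
        (trans (cong ℓ (assoc (s i) v (s j))) ℓsvt)
        (trans (cong ℓ (trans (cong (s i ·_) (assoc (s i) v (s j))) (s-cancelˡ i (v · s j)))) ℓvt))

    config : ∀ v → Configuration (does (ℓ v <? ℓ (sv v))) (does (ℓ (sv v) <? ℓ (svt v))) (does (ℓ v <? ℓ (vt v))) (does (ℓ (vt v) <? ℓ (svt v))) (h (sv v)) (h (vt v))
    config v = configuration (ℓ v) (ℓ (sv v)) (ℓ (vt v)) (ℓ (svt v)) (h (sv v)) (h (vt v))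
      (ℓ-s·-cases i v) (ℓ-·s-cases j v) (ℓ-svt-cases v) (ℓ-s·-cases i (vt v)) (sv≡vt-up v) (sv≡vt-down v)

  lmulS-rmulWord : ∀ i w h → lmulS i (rmulWord w h) ≃ rmulWord w (lmulS i h)
  lmulS-rmulWord i []      h = ≃-refl
  lmulS-rmulWord i (j ∷ w) h = ≃-trans (lmulS-rmulWord i w (rmulS j h)) (cong-≃ (IsLinear-rmulWord w) (lmulS-rmulS i j h))

  lmulWord-rmulWord : ∀ a w h → lmulWord a (rmulWord w h) ≃ rmulWord w (lmulWord a h)
  lmulWord-rmulWord []      w h = ≃-refl
  lmulWord-rmulWord (i ∷ a) w h = ≃-trans (cong-≃ (IsLinear-lmulS i) (lmulWord-rmulWord a w h)) (lmulS-rmulWord i w (lmulWord a h))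

  -- Associativity

  T-*H : ∀ z h → T z *H h ≃ lmulWord (red z) h
  T-*H z h = begin
    T z *H h                                                        ≈⟨ *H-∑ (T z) h ⟩
    ∑ elems (λ x → h x ⊙ rmulWord (red x) (T z))                    ≈⟨ ∑-cong elems (λ x → ⊙-congˡ (h x) (commute x)) ⟩
    ∑ elems (λ x → h x ⊙ lmulWord (red z) (rmulWord (red x) (T e))) ≈⟨ ∑-cong elems (λ x → ⊙-congˡ (h x) (cong-≃ λz (rmulWord-red x))) ⟩
    ∑ elems (λ x → h x ⊙ lmulWord (red z) (T x))                    ≈⟨ ∑-cong elems (λ x → ≃-sym (⊙-hom λz (h x) (T x))) ⟩
    ∑ elems (λ x → lmulWord (red z) (h x ⊙ T x))                    ≈⟨ ≃-sym (∑-linear λz elems (λ x → h x ⊙ T x)) ⟩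
    lmulWord (red z) (∑ elems (λ x → h x ⊙ T x))                    ≈⟨ cong-≃ λz (≃-sym (basis-expansion h)) ⟩
    lmulWord (red z) h                                              ∎
    where
    open SetoidReasoning setoid
    λz = IsLinear-lmulWord (red z)
    commute : ∀ x → rmulWord (red x) (T z) ≃ lmulWord (red z) (rmulWord (red x) (T e))
    commute x = ≃-trans (cong-≃ (IsLinear-rmulWord (red x)) (≃-sym (lmulWord-red z))) (≃-sym (lmulWord-rmulWord (red z) (red x) (T e)))

  rmulWord-≃-*H : ∀ w a → rmulWord w a ≃ a *H rmulWord w (T e)
  rmulWord-≃-*H w = linear-ext (IsLinear-rmulWord w) (IsLinear-*Hˡ (rmulWord w (T e))) on-basis
    where
    on-basis : ∀ z → rmulWord w (T z) ≃ T z *H rmulWord w (T e)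
    on-basis z = begin
      rmulWord w (T z)                    ≈⟨ cong-≃ (IsLinear-rmulWord w) (≃-sym (lmulWord-red z)) ⟩
      rmulWord w (lmulWord (red z) (T e)) ≈⟨ ≃-sym (lmulWord-rmulWord (red z) w (T e)) ⟩
      lmulWord (red z) (rmulWord w (T e)) ≈⟨ ≃-sym (T-*H z (rmulWord w (T e))) ⟩
      T z *H rmulWord w (T e)             ∎
      where open SetoidReasoning setoid

  rmulWord-++ : ∀ xs ys h → rmulWord (xs Data.List.++ ys) h ≡ rmulWord ys (rmulWord xs h)
  rmulWord-++ []       ys h = refl
  rmulWord-++ (x ∷ xs) ys h = rmulWord-++ xs ys (rmulS x h)

  rmulWord-*H : ∀ w a b → rmulWord w (a *H b) ≃ a *H rmulWord w b
  rmulWord-*H w a = linear-ext (IsLinear-∘ (IsLinear-*Hʳ a) (IsLinear-rmulWord w)) (IsLinear-∘ (IsLinear-rmulWord w) (IsLinear-*Hʳ a)) on-basis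
    where
    on-basis : ∀ y → rmulWord w (a *H T y) ≃ a *H rmulWord w (T y)
    on-basis y = begin
      rmulWord w (a *H T y)                      ≈⟨ cong-≃ (IsLinear-rmulWord w) (*H-T a y) ⟩
      rmulWord w (rmulWord (red y) a)            ≈⟨ ≃-reflexive (sym (rmulWord-++ (red y) w a)) ⟩
      rmulWord (red y Data.List.++ w) a          ≈⟨ rmulWord-≃-*H (red y Data.List.++ w) a ⟩
      a *H rmulWord (red y Data.List.++ w) (T e) ≈⟨ ≃-reflexive (cong (a *H_) (rmulWord-++ (red y) w (T e))) ⟩
      a *H rmulWord w (rmulWord (red y) (T e))   ≈⟨ cong-≃ (IsLinear-*Hʳ a) (cong-≃ (IsLinear-rmulWord w) (rmulWord-red y)) ⟩
      a *H rmulWord w (T y)                      ∎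
      where open SetoidReasoning setoid

  *H-assoc : ∀ a b c → (a *H b) *H c ≃ a *H (b *H c)
  *H-assoc a b c = begin
    (a *H b) *H c                                   ≈⟨ *H-∑ (a *H b) c ⟩
    ∑ elems (λ x → c x ⊙ rmulWord (red x) (a *H b)) ≈⟨ ∑-cong elems (λ x → ⊙-congˡ (c x) (rmulWord-*H (red x) a b)) ⟩
    ∑ elems (λ x → c x ⊙ (a *H rmulWord (red x) b)) ≈⟨ ∑-cong elems (λ x → ≃-sym (⊙-hom (IsLinear-*Hʳ a) (c x) (rmulWord (red x) b))) ⟩
    ∑ elems (λ x → a *H (c x ⊙ rmulWord (red x) b)) ≈⟨ ≃-sym (∑-linear (IsLinear-*Hʳ a) elems (λ x → c x ⊙ rmulWord (red x) b)) ⟩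
    a *H ∑ elems (λ x → c x ⊙ rmulWord (red x) b)   ≈⟨ cong-≃ (IsLinear-*Hʳ a) (≃-sym (*H-∑ b c)) ⟩
    a *H (b *H c)                                   ∎
    where open SetoidReasoning setoid

  heckeMonoid : Monoid 0ℓ 0ℓ
  heckeMonoid = record
    { Carrier = H ; _≈_ = _≃_ ; _∙_ = _*H_ ; ε = T e
    ; isMonoid = record
      { isSemigroup = record
        { isMagma = record
          { isEquivalence = Setoid.isEquivalence setoid
          ; ∙-cong = λ {a} {a'} {b} {b'} a≃a' b≃b' → ≃-trans (cong-≃ (IsLinear-*Hˡ b) a≃a') (cong-≃ (IsLinear-*Hʳ a') b≃b') }
        ; assoc = *H-assoc }
      ; identity = T-e-*H , *H-T-e } }
    where
    T-e-*H : ∀ h → T e *H h ≃ h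
    T-e-*H h = ≃-trans (T-*H e h) (≃-reflexive (cong (λ w → lmulWord w h) red-e))
    *H-T-e : ∀ h → h *H T e ≃ h
    *H-T-e h = ≃-trans (*H-T h e) (≃-reflexive (cong (λ w → rmulWord w h) red-e))

  open MonoidInverses heckeMonoid using (IsInverse; inverse-∙; inverse-of-prefix)

  *H-T-s : ∀ i h → h *H T (s i) ≃ rmulS i h
  *H-T-s i h with red-s i
  ... | j , red≡[j] , sj≡si = ≃-trans (*H-T h (s i)) (≃-trans (≃-reflexive (cong (λ w → rmulWord w h) red≡[j]))
                                (pointwise λ v → L.reflexive (cong (λ t → step (does (ℓ v <? ℓ (v · t))) (h (v · t)) (h v)) sj≡si)))

  T-·s : ∀ u i → ℓ (u · s i) ≡ suc (ℓ u) → T u *H T (s i) ≃ T (u · s i)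
  T-·s u i up = ≃-trans (*H-T-s i (T u)) (rmulS-T-up i u up)

  T-s-quadratic : ∀ i → T (s i) *H T (s i) ≃ qL ⊙ T e +H (qL -L 1L) ⊙ T (s i)
  T-s-quadratic i = ≃-trans (*H-T-s i (T (s i)))
                   (≃-trans (rmulS-T-down i (s i) ℓ-s≡) (≃-reflexive (cong (λ z → qL ⊙ T z +H (qL -L 1L) ⊙ T (s i)) (s-involutive i))))
    where
    ℓ-s≡ : ℓ (s i) ≡ suc (ℓ (s i · s i))
    ℓ-s≡ = trans (ℓ-s i) (cong suc (sym (trans (cong ℓ (s-involutive i)) ℓ-e)))

  q⁻¹ : Laurent
  q⁻¹ = mkL [ + 1 ] -[1+ 0 ]

  q⁻¹*q : q⁻¹ *L qL ≋ 1L
  q⁻¹*q = coeffwise λ _ → refl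

  unit-cancel : ∀ {p q} → p *L q ≋ 1L → ∀ a b → p *L (q *L a +L (q -L 1L) *L b) +L (p -L 1L) *L b ≋ a
  unit-cancel {p} {q} pq≋1 a b = begin
    p *L (q *L a +L (q -L 1L) *L b) +L (p -L 1L) *L b             ≈⟨ distribute p q 1L a b ⟩
    (p *L q) *L a +L ((p *L q) -L 1L) *L b +L (p -L p *L 1L) *L b ≈⟨ L.+-cong (L.+-cong (L.*-cong pq≋1 (L.refl {a})) (L.*-cong (L.+-cong pq≋1 (L.refl { -L 1L})) (L.refl {b})))
                                                                               (L.*-cong (L.+-cong (L.refl {p}) (L.-‿cong (L.*-identityʳ p))) (L.refl {b})) ⟩
    1L *L a +L (1L -L 1L) *L b +L (p -L p) *L b                   ≈⟨ L.+-cong (L.+-cong (L.*-identityˡ a) (L.trans (L.*-cong (L.-‿inverseʳ 1L) (L.refl {b})) (L.zeroˡ b)))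
                                                                               (L.trans (L.*-cong (L.-‿inverseʳ p) (L.refl {b})) (L.zeroˡ b)) ⟩
    a +L 0L +L 0L                                                 ≈⟨ L.trans (L.+-identityʳ (a +L 0L)) (L.+-identityʳ a) ⟩
    a                                                             ∎
    where
    open SetoidReasoning L.setoid
    distribute : ∀ p q o a b → p *L (q *L a +L (q -L o) *L b) +L (p -L o) *L b ≋ (p *L q) *L a +L ((p *L q) -L o) *L b +L (p -L p *L o) *L b
    distribute = solve-∀ almostCommutativeRing

  T-s⁻¹ : Fin rank → H
  T-s⁻¹ i = q⁻¹ ⊙ T (s i) +H (q⁻¹ -L 1L) ⊙ T e

  T-s-inverse : ∀ i → IsInverse (T (s i)) (T-s⁻¹ i)
  T-s-inverse i = on-side (IsLinear-*Hʳ (T (s i))) (*H-T-e (T (s i))) ≃-refl , on-side (IsLinear-*Hˡ (T (s i))) (T-e-*H (T (s i))) ≃-refl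
    where
    open Monoid heckeMonoid using () renaming (identityˡ to T-e-*H; identityʳ to *H-T-e)
    on-side : ∀ {f} → IsLinear f → f (T e) ≃ T (s i) → f (T (s i)) ≃ T (s i) *H T (s i) → f (T-s⁻¹ i) ≃ T e
    on-side {f} lin f-e f-s = begin
      f (T-s⁻¹ i)                                                       ≈⟨ linear-combination lin q⁻¹ (q⁻¹ -L 1L) (T (s i)) (T e) ⟩
      q⁻¹ ⊙ f (T (s i)) +H (q⁻¹ -L 1L) ⊙ f (T e)                        ≈⟨ +H-cong (⊙-congˡ q⁻¹ (≃-trans f-s (T-s-quadratic i))) (⊙-congˡ (q⁻¹ -L 1L) f-e) ⟩
      q⁻¹ ⊙ (qL ⊙ T e +H (qL -L 1L) ⊙ T (s i)) +H (q⁻¹ -L 1L) ⊙ T (s i) ≈⟨ pointwise (λ v → unit-cancel {q⁻¹} {qL} q⁻¹*q (T e v) (T (s i) v)) ⟩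
      T e                                                               ∎
      where open SetoidReasoning setoid

  T-s≃ : ∀ i → T (s i) ≃ qL ⊙ T-s⁻¹ i +H (qL -L 1L) ⊙ T e
  T-s≃ i = pointwise λ v → L.sym (unit-cancel {qL} {q⁻¹} (L.trans (L.*-comm qL q⁻¹) q⁻¹*q) (T (s i) v) (T e v))

  T-s-*H : ∀ i X → T (s i) *H X ≃ qL ⊙ (T-s⁻¹ i *H X) +H (qL -L 1L) ⊙ X
  T-s-*H i X = begin
    T (s i) *H X                                   ≈⟨ cong-≃ (IsLinear-*Hˡ X) (T-s≃ i) ⟩
    (qL ⊙ T-s⁻¹ i +H (qL -L 1L) ⊙ T e) *H X        ≈⟨ linear-combination (IsLinear-*Hˡ X) qL (qL -L 1L) (T-s⁻¹ i) (T e) ⟩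
    qL ⊙ (T-s⁻¹ i *H X) +H (qL -L 1L) ⊙ (T e *H X) ≈⟨ +H-cong ≃-refl (⊙-congˡ (qL -L 1L) (identityˡ X)) ⟩
    qL ⊙ (T-s⁻¹ i *H X) +H (qL -L 1L) ⊙ X          ∎
    where
    open SetoidReasoning setoid
    open Monoid heckeMonoid using (identityˡ)

  Tword-∷ʳ : ∀ w i X → Tword (w ∷ʳ i) *H X ≃ Tword w *H (T (s i) *H X)
  Tword-∷ʳ w i X = ≃-trans (cong-≃ (IsLinear-*Hˡ X) (Tword-∷ʳ-T w)) (*H-assoc (Tword w) (T (s i)) X)
    where
    open Monoid heckeMonoid using (identityˡ; identityʳ)
    Tword-∷ʳ-T : ∀ w → Tword (w ∷ʳ i) ≃ Tword w *H T (s i)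
    Tword-∷ʳ-T []      = ≃-trans (identityʳ (T (s i))) (≃-sym (identityˡ (T (s i))))
    Tword-∷ʳ-T (j ∷ w) = ≃-trans (cong-≃ (IsLinear-*Hʳ (T (s j))) (Tword-∷ʳ-T w)) (≃-sym (*H-assoc (T (s j)) (Tword w) (T (s i))))

  inverse-·s-down : ∀ u i {X} → ℓ u ≡ suc (ℓ (u · s i)) → IsInverse (T u) X → IsInverse (T (u · s i)) (T (s i) *H X)
  inverse-·s-down u i down inverse = inverse-of-prefix T-us-s≃T-u inverse (T-s-inverse i)
    where
    T-us-s≃T-u : T (u · s i) *H T (s i) ≃ T u
    T-us-s≃T-u = ≃-trans (T-·s (u · s i) i (trans (cong ℓ (s-cancelʳ i u)) down)) (≃-reflexive (cong T (s-cancelʳ i u)))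

  inverse-·s-up : ∀ u i {X} → ℓ (u · s i) ≡ suc (ℓ u) → IsInverse (T u) X → IsInverse (T (u · s i)) (T-s⁻¹ i *H X)
  inverse-·s-up u i {X} up inverse = inverse-∙ {T u} {T (s i)} {T (u · s i)} {X} {T-s⁻¹ i} (T-·s u i up) inverse (T-s-inverse i)

  Rrev-∷-down : ∀ u i rw → ℓ u ≡ suc (ℓ (u · s i)) → Rrev u (i ∷ rw) ≡ Rrev (u · s i) rw
  Rrev-∷-down u i rw down = cong (λ b → if b then Rrev (u · s i) rw else qL *L Rrev (u · s i) rw +L (qL -L 1L) *L Rrev u rw)
                                 (dec-true (ℓ (u · s i) <? ℓ u) (subst (ℓ (u · s i) <_) (sym down) (ℕ.n<1+n _)))

  Rrev-∷-up : ∀ u i rw → ℓ (u · s i) ≡ suc (ℓ u) → Rrev u (i ∷ rw) ≡ qL *L Rrev (u · s i) rw +L (qL -L 1L) *L Rrev u rw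
  Rrev-∷-up u i rw up = cong (λ b → if b then Rrev (u · s i) rw else qL *L Rrev (u · s i) rw +L (qL -L 1L) *L Rrev u rw)
                             (dec-false (ℓ (u · s i) <? ℓ u) (λ us<u → ℕ.<-asym us<u (subst (ℓ u <_) (sym up) (ℕ.n<1+n _))))

  Tword-reverse-∷ : ∀ i rw X → Tword (reverse (i ∷ rw)) *H X ≃ Tword (reverse rw) *H (T (s i) *H X)
  Tword-reverse-∷ i rw X = ≃-trans (≃-reflexive (cong (λ w → Tword w *H X) (List.unfold-reverse i rw))) (Tword-∷ʳ (reverse rw) i X)

  module _ (τ : H → Laurent) (τ⁻ : IsTauMinus τ) where

    private
      τ-≃ : ∀ {h h'} → h ≃ h' → τ h ≋ τ h'
      τ-≃ h≃h' = coeffwise (IsTauMinus.cong τ⁻ (≃⇒≈H h≃h'))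

      τ-linear : ∀ c d h h' → τ (c ⊙ h +H d ⊙ h') ≋ c *L τ h +L d *L τ h'
      τ-linear c d h h' = L.trans (coeffwise (IsTauMinus.additive τ⁻ (c ⊙ h) (d ⊙ h')))
                                  (L.+-cong (coeffwise (IsTauMinus.homogeneous τ⁻ c h)) (coeffwise (IsTauMinus.homogeneous τ⁻ d h')))

      τ-inverse : ∀ u X → IsInverse (T u) X → τ X ≋ δ u e
      τ-inverse u X (uX≃e , Xu≃e) = coeffwise (IsTauMinus.onInverses τ⁻ u X (≃⇒≈H uX≃e , ≃⇒≈H Xu≃e))

    Rrev≋τ : ∀ rw u X → IsInverse (T u) X → Rrev u rw ≋ τ (Tword (reverse rw) *H X)
    Rrev≋τ []       u X inverse = L.sym (L.trans (τ-≃ (Monoid.identityˡ heckeMonoid X)) (τ-inverse u X inverse))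
    Rrev≋τ (i ∷ rw) u X inverse with ℓ-·s-cases i u
    ... | inj₂ down = begin
      Rrev u (i ∷ rw)                   ≡⟨ Rrev-∷-down u i rw down ⟩
      Rrev (u · s i) rw                 ≈⟨ Rrev≋τ rw (u · s i) (T (s i) *H X) (inverse-·s-down u i down inverse) ⟩
      τ (Tword w *H (T (s i) *H X))     ≈⟨ τ-≃ (≃-sym (Tword-reverse-∷ i rw X)) ⟩
      τ (Tword (reverse (i ∷ rw)) *H X) ∎
      where
      open SetoidReasoning L.setoid
      w = reverse rw
    ... | inj₁ up = begin
      Rrev u (i ∷ rw)
        ≡⟨ Rrev-∷-up u i rw up ⟩
      qL *L Rrev (u · s i) rw +L (qL -L 1L) *L Rrev u rw
        ≈⟨ L.+-cong (L.*-cong (L.refl {qL}) (Rrev≋τ rw (u · s i) (T-s⁻¹ i *H X) (inverse-·s-up u i up inverse)))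
                    (L.*-cong (L.refl {qL -L 1L}) (Rrev≋τ rw u X inverse)) ⟩
      qL *L τ (Tword w *H (T-s⁻¹ i *H X)) +L (qL -L 1L) *L τ (Tword w *H X)
        ≈⟨ L.sym (τ-linear qL (qL -L 1L) (Tword w *H (T-s⁻¹ i *H X)) (Tword w *H X)) ⟩
      τ (qL ⊙ (Tword w *H (T-s⁻¹ i *H X)) +H (qL -L 1L) ⊙ (Tword w *H X))
        ≈⟨ τ-≃ (≃-sym (linear-combination (IsLinear-*Hʳ (Tword w)) qL (qL -L 1L) (T-s⁻¹ i *H X) X)) ⟩
      τ (Tword w *H (qL ⊙ (T-s⁻¹ i *H X) +H (qL -L 1L) ⊙ X))
        ≈⟨ τ-≃ (cong-≃ (IsLinear-*Hʳ (Tword w)) (≃-sym (T-s-*H i X))) ⟩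
      τ (Tword w *H (T (s i) *H X))
        ≈⟨ τ-≃ (≃-sym (Tword-reverse-∷ i rw X)) ⟩
      τ (Tword (reverse (i ∷ rw)) *H X) ∎
      where
      open SetoidReasoning L.setoid
      w = reverse rw

corollary5p4 : (C : CoxeterSystem) (F : Finite C) →
    let open CoxeterSystem C in
    let open Hecke C F in
    (τ : H → Laurent) → IsTauMinus τ →
    (𝐰 : List (Fin rank)) (u : W) (Tu⁻¹ : H) → IsInverseOfT u Tu⁻¹ →
    R u 𝐰 ≈L τ (Tword 𝐰 *H Tu⁻¹)
corollary5p4 C F τ τ⁻ 𝐰 u Tu⁻¹ (TuTu⁻¹≈1 , Tu⁻¹Tu≈1) = ≋⇒≈L (begin
  Rrev u (reverse 𝐰)                      ≈⟨ Rrev≋τ τ τ⁻ (reverse 𝐰) u Tu⁻¹ (≈H⇒≃ TuTu⁻¹≈1 , ≈H⇒≃ Tu⁻¹Tu≈1) ⟩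
  τ (Tword (reverse (reverse 𝐰)) *H Tu⁻¹) ≡⟨ cong (λ w → τ (Tword w *H Tu⁻¹)) (reverse-involutive 𝐰) ⟩
  τ (Tword 𝐰 *H Tu⁻¹)                     ∎)
  where
  open CoxeterSystem C
  open Hecke C F
  open HeckeAlgebra C F
  open LaurentRing using (≋⇒≈L)
  open SetoidReasoning L.setoid
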